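{- For $k\ge 2$, \[ V_k(x;1,b)=x+b^{2k}x^k+2b^kx^kC(x). \]
   Context: Consider tilings of the $2k\times n$ rectangle $[0,n]\times[0,2k]$ by $k\times 1$ tiles, with weight $a^vb^h$ ($v,h$ the numbers of vertical and horizontal tiles). A tiling has a horizontal fault at $y=k$ if no tile interior meets the line $y=k$; it is vertically fault-free if for no integer $0<c<n$ the line $x=c$ avoids all tile interiors. $v_{k,n}(a,b)$ is the total weight of vertically fault-free tilings of the $2k\times n$ rectangle having a horizontal fault at $y=k$, and $V_k(x;a,b)=\sum_{n\ge1}v_{k,n}(a,b)x^n$; $V_k(x;1,b)$ is its specialization at $a=1$. $\mathrm{TComp}(n,k)$ is the set of compositions of $n$ with all parts at most $k-1$ and every two consecutive parts summing to at least $k$ (the empty composition for $n=0$). Set $c(n)=\sum_{\beta\in\mathrm{TComp}(n,k)}b^{k\ell(\beta)}$, where $\ell(\beta)$ is the number of parts, and $C(x)=\sum_{n\ge0}c(n)x^n$. -}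

module Defs where

open import Data.Nat using (ℕ; zero; suc; _+_; _*_; _∸_; _≤_; _<_)
open import Data.Maybe using (Maybe; just; nothing)
open import Data.Vec using (Vec; []; _∷_; replicate)
open import Data.List using (List; length)
open import Data.Nat.ListAction using (sum)
open import Data.List.Relation.Unary.All using (All)
open import Data.List.Relation.Unary.Linked using (Linked)
open import Data.Product using (Σ; _×_; _,_)
open import Data.Sum using (_⊎_)
open import Data.Fin using (Fin)
open import Relation.Nullary using (¬_)
open import Relation.Binary.PropositionalEquality using (_≡_)

data Ori : Set where
  H V : Ori

width : ℕ → Ori → ℕ
width k H = k
width k V = 1

height : ℕ → Ori → ℕ
height k H = 1
height k V = k

-- A placement of tiles in the 2k × n rectangle [0,n]×[0,2k] is recorded by
-- the grid of unit cells: the cell [x,x+1]×[y,y+1] (x < n, y < 2k) holds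
-- `just o` iff a tile of orientation o has its lower-left corner at (x,y),
-- and `nothing` otherwise.  Column-major: outer index x, inner index y.
Grid : ℕ → ℕ → Set
Grid k n = Vec (Vec (Maybe Ori) (2 * k)) n

vat : ∀ {A : Set} {m : ℕ} → A → Vec A m → ℕ → A
vat d [] _ = d
vat d (a ∷ _) zero = a
vat d (_ ∷ v) (suc i) = vat d v i

anchorAt : ∀ k {n} → Grid k n → ℕ → ℕ → Maybe Ori
anchorAt k g x y = vat nothing (vat (replicate (2 * k) nothing) g x) y

Covers : ∀ k {n} → Grid k n → ℕ × ℕ → ℕ × ℕ → Set
Covers k g (x' , y') (x , y) =
  Σ Ori λ o → anchorAt k g x' y' ≡ just o
            × x' ≤ x × x < x' + width k o × y' ≤ y × y < y' + height k o

IsTiling : ∀ k n → Grid k n → Set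
IsTiling k n g =
    (∀ x y o → anchorAt k g x y ≡ just o → x + width k o ≤ n × y + height k o ≤ 2 * k)
  × (∀ x y → x < n → y < 2 * k → Σ (ℕ × ℕ) λ p → Covers k g p (x , y))
  × (∀ x y p q → Covers k g p (x , y) → Covers k g q (x , y) → p ≡ q)

VerticalFaultAt : ∀ k {n} → Grid k n → ℕ → Set
VerticalFaultAt k g c =
  ∀ x y o → anchorAt k g x y ≡ just o → ¬ (x < c × c < x + width k o)

HorizontalFaultAt : ∀ k {n} → Grid k n → ℕ → Set
HorizontalFaultAt k g c =
  ∀ x y o → anchorAt k g x y ≡ just o → ¬ (y < c × c < y + height k o)

VerticallyFaultFree : ∀ k n → Grid k n → Set
VerticallyFaultFree k n g = ∀ c → 0 < c → c < n → ¬ VerticalFaultAt k g c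

countHcol : ∀ {m} → Vec (Maybe Ori) m → ℕ
countHcol [] = 0
countHcol (just H ∷ v) = suc (countHcol v)
countHcol (just V ∷ v) = countHcol v
countHcol (nothing ∷ v) = countHcol v

numH : ∀ k {n} → Grid k n → ℕ
numH k [] = 0
numH k (col ∷ g) = countHcol col + numH k g

-- Vertically fault-free tilings of the 2k × n rectangle with a horizontal
-- fault at y = k and exactly h horizontal tiles (so weight 1^v b^h = b^h).
-- The properties are irrelevant fields, so such objects are equal iff their
-- grids are equal, i.e. iff they are the same tiling.
record VFTiling (k n h : ℕ) : Set where
  constructor mkVFT
  field
    grid       : Grid k n
    .tiling    : IsTiling k n grid
    .hfault    : HorizontalFaultAt k grid k
    .vfree     : VerticallyFaultFree k n grid
    .numHoriz  : numH k grid ≡ h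

record TComp (m k : ℕ) : Set where
  constructor mkTComp
  field
    parts    : List ℕ
    .pos     : All (1 ≤_) parts
    .sums    : sum parts ≡ m
    .small   : All (_< k) parts
    .adjBig  : Linked (λ a b → k ≤ a + b) parts

-- The set whose elements of "degree" (n , h) are counted by the coefficient
-- of x^n b^h in  x + b^(2k) x^k + 2 b^k x^k C(x),
-- where C(x) = Σ_m Σ_{β ∈ TComp(m,k)} b^(k ℓ(β)) x^m.

RHSTerm : (k n h : ℕ) → Set
RHSTerm k n h =
    (n ≡ 1 × h ≡ 0)
  ⊎ (n ≡ k × h ≡ 2 * k)
  ⊎ (Fin 2 × Σ ℕ λ m → Σ (TComp m k) λ β →
        n ≡ k + m × h ≡ k + k * length (TComp.parts β))

{-# OPTIONS --safe #-}
module Submission where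

-- A horizontal fault at y = k splits a tiling into tilings of two k × n strips.  In a
-- strip a horizontal tile forces the k − 1 tiles above it, so a strip tiling is a word
-- over V (one column) and H (a k × k block of k horizontal tiles, weight b^k), and
-- vertical fault-freeness says that the two words share no interior breakpoint.  If
-- both words start with the same letter, the breakpoint after it forces n = 1 (VV) or
-- n = k (HH).  Otherwise the H-blocks of the two words alternate, and the distances
-- between the starts of consecutive blocks form a composition β ∈ TComp(n − k, k); the
-- 1 + ℓ(β) blocks give b^(k + k ℓ(β)), and the choice of the word starting with H gives
-- the factor 2.

open import Defs
open import Data.Nat using (ℕ; zero; suc; _+_; _*_; _∸_; _≤_; _<_; z≤n; s≤s; _≟_; _<?_)
open import Data.Nat.Properties
open import Data.Nat.Induction using (<-rec)
open import Data.Nat.Tactic.RingSolver using (solve-∀)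
open import Algebra.Properties.CommutativeSemigroup +-commutativeSemigroup using (interchange)
open import Data.Nat.ListAction using (sum)
open import Data.Maybe using (Maybe; just; nothing)
import Data.Maybe.Properties as Maybe
open import Data.List using (List; []; _∷_; _++_; length; replicate)
import Data.List.Properties as List
open import Data.List.Relation.Unary.All using (All; []; _∷_)
open import Data.List.Relation.Unary.Linked using (Linked; []; [-]; _∷_)
open import Data.Vec using (Vec; []; _∷_; tabulate)
import Data.Vec as Vec
import Data.Vec.Properties as Vec
open import Data.Fin using (Fin; zero; suc; toℕ)
open import Data.Product using (Σ; _×_; _,_; proj₁; proj₂)
open import Data.Sum using (_⊎_; inj₁; inj₂)
open import Data.Empty using (⊥; ⊥-elim; ⊥-elim-irr)
open import Function using (_∘_; _∋_)
open import Function.Bundles using (_↔_; mk↔ₛ′)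
open import Function.Properties.Inverse using (↔-trans)
open import Relation.Nullary using (¬_; yes; no)
open import Relation.Nullary.Decidable using (recompute)
open import Relation.Binary.Definitions using (DecidableEquality)
open import Relation.Binary.PropositionalEquality

module _ {A : Set} where

  vat-tabulate : ∀ m (f : ℕ → A) d {x} → x < m → vat d (tabulate {n = m} (f ∘ toℕ)) x ≡ f x
  vat-tabulate (suc m) f d {zero}  _          = refl
  vat-tabulate (suc m) f d {suc x} (s≤s x<m) = vat-tabulate m (f ∘ suc) d x<m

  vat-tabulate-≥ : ∀ m (f : ℕ → A) d {x} → m ≤ x → vat d (tabulate {n = m} (f ∘ toℕ)) x ≡ d
  vat-tabulate-≥ zero    f d _         = refl
  vat-tabulate-≥ (suc m) f d (s≤s m≤x) = vat-tabulate-≥ m (f ∘ suc) d m≤x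

  vat-replicate : ∀ m (d : A) x → vat d (Vec.replicate m d) x ≡ d
  vat-replicate zero    d x       = refl
  vat-replicate (suc m) d zero    = refl
  vat-replicate (suc m) d (suc x) = vat-replicate m d x

  tabulate-vat : ∀ m d (v : Vec A m) → tabulate (vat d v ∘ toℕ) ≡ v
  tabulate-vat zero    d []      = refl
  tabulate-vat (suc m) d (a ∷ v) = cong (a ∷_) (tabulate-vat m d v)

sumBelow : ℕ → (ℕ → ℕ) → ℕ
sumBelow zero    f = 0
sumBelow (suc n) f = f 0 + sumBelow n (f ∘ suc)

sumBelow-cong : ∀ n {f g} → f ≗ g → sumBelow n f ≡ sumBelow n g
sumBelow-cong zero    f≗g = refl
sumBelow-cong (suc n) f≗g = cong₂ _+_ (f≗g 0) (sumBelow-cong n (f≗g ∘ suc))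

sumBelow-+ : ∀ m n f → sumBelow (m + n) f ≡ sumBelow m f + sumBelow n (f ∘ (m +_))
sumBelow-+ zero    n f = refl
sumBelow-+ (suc m) n f = trans (cong (f 0 +_) (sumBelow-+ m n (f ∘ suc))) (sym (+-assoc (f 0) _ _))

sumBelow-distrib-+ : ∀ n f g → sumBelow n (λ x → f x + g x) ≡ sumBelow n f + sumBelow n g
sumBelow-distrib-+ zero    f g = refl
sumBelow-distrib-+ (suc n) f g =
  trans (cong (f 0 + g 0 +_) (sumBelow-distrib-+ n (f ∘ suc) (g ∘ suc))) (interchange (f 0) (g 0) _ _)

sumBelow-*ˡ : ∀ n c f → sumBelow n (λ x → c * f x) ≡ c * sumBelow n f
sumBelow-*ˡ zero    c f = sym (*-zeroʳ c)
sumBelow-*ˡ (suc n) c f = trans (cong (c * f 0 +_) (sumBelow-*ˡ n c (f ∘ suc))) (sym (*-distribˡ-+ c (f 0) _))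

≤∧<+1⇒≡ : ∀ {m n} → m ≤ n → n < m + 1 → m ≡ n
≤∧<+1⇒≡ {m} {n} m≤n n<m+1 = ≤-antisym m≤n (m<1+n⇒m≤n (subst (n <_) (+-comm m 1) n<m+1))

data Split (m : ℕ) : ℕ → Set where
  below : ∀ {x} → x < m → Split m x
  above : ∀ y → Split m (m + y)

split : ∀ m x → Split m x
split m x with x <? m
... | yes x<m = below x<m
... | no  x≮m = subst (Split m) (m+[n∸m]≡n (≮⇒≥ x≮m)) (above (x ∸ m))

Row : Set
Row = ℕ → Maybe Ori

Word : Set
Word = List Ori

Anchors : Set
Anchors = ℕ → ℕ → Maybe Ori

shiftʳ : ℕ → Row → Row
shiftʳ zero    r x       = r x
shiftʳ (suc m) r zero    = nothing
shiftʳ (suc m) r (suc x) = shiftʳ m r x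

shiftˡ : ℕ → Row → Row
shiftˡ m r x = r (m + x)

shiftʳ-< : ∀ m r {x} → x < m → shiftʳ m r x ≡ nothing
shiftʳ-< (suc m) r {zero}  _         = refl
shiftʳ-< (suc m) r {suc x} (s≤s x<m) = shiftʳ-< m r x<m

shiftʳ-+ : ∀ m r x → shiftʳ m r (m + x) ≡ r x
shiftʳ-+ zero    r x = refl
shiftʳ-+ (suc m) r x = shiftʳ-+ m r x

shiftʳ-just : ∀ m r x {o} → shiftʳ m r x ≡ just o → Σ ℕ λ z → x ≡ m + z × r z ≡ just o
shiftʳ-just zero    r x       eq = x , refl , eq
shiftʳ-just (suc m) r (suc x) eq with shiftʳ-just m r x eq
... | z , refl , rz≡o = z , refl , rz≡o

shiftʳ-cong : ∀ m {r r′} → r ≗ r′ → shiftʳ m r ≗ shiftʳ m r′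
shiftʳ-cong zero    r≗r′ x       = r≗r′ x
shiftʳ-cong (suc m) r≗r′ zero    = refl
shiftʳ-cong (suc m) r≗r′ (suc x) = shiftʳ-cong m r≗r′ x

aboveBase : Maybe Ori → Maybe Ori
aboveBase (just H) = just H
aboveBase _        = nothing

aboveBase-just : ∀ a {o} → aboveBase a ≡ just o → o ≡ H × a ≡ just H
aboveBase-just (just H) refl = refl , refl

fill : ℕ → Maybe Ori → Row
fill zero    a y       = nothing
fill (suc m) a zero    = a
fill (suc m) a (suc y) = fill m a y

fill-< : ∀ m a {y} → y < m → fill m a y ≡ a
fill-< (suc m) a {zero}  _         = refl
fill-< (suc m) a {suc y} (s≤s y<m) = fill-< m a y<m

fill-≥ : ∀ m a {y} → m ≤ y → fill m a y ≡ nothing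
fill-≥ zero    a _         = refl
fill-≥ (suc m) a (s≤s m≤y) = fill-≥ m a m≤y

fill-just : ∀ m a y {o} → fill m a y ≡ just o → y < m × a ≡ just o
fill-just (suc m) a zero    eq = s≤s z≤n , eq
fill-just (suc m) a (suc y) eq with fill-just m a y eq
... | y<m , a≡o = s≤s y<m , a≡o

fill-nothing : ∀ m y → fill m nothing y ≡ nothing
fill-nothing zero    y       = refl
fill-nothing (suc m) zero    = refl
fill-nothing (suc m) (suc y) = fill-nothing m y

splice : ℕ → Row → Row → Row
splice zero    f g y       = g y
splice (suc m) f g zero    = f zero
splice (suc m) f g (suc y) = splice m (f ∘ suc) g y

splice-< : ∀ m f g {y} → y < m → splice m f g y ≡ f y
splice-< (suc m) f g {zero}  _         = refl
splice-< (suc m) f g {suc y} (s≤s y<m) = splice-< m (f ∘ suc) g y<m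

splice-+ : ∀ m f g z → splice m f g (m + z) ≡ g z
splice-+ zero    f g z = refl
splice-+ (suc m) f g z = splice-+ m (f ∘ suc) g z

_≟ᴼ_ : DecidableEquality Ori
H ≟ᴼ H = yes refl
V ≟ᴼ V = yes refl
H ≟ᴼ V = no λ ()
V ≟ᴼ H = no λ ()

hCount : Maybe Ori → ℕ
hCount (just H) = 1
hCount _        = 0

hCount-aboveBase : ∀ a → hCount (aboveBase a) ≡ hCount a
hCount-aboveBase (just H) = refl
hCount-aboveBase (just V) = refl
hCount-aboveBase nothing  = refl

#H : Word → ℕ
#H []      = 0
#H (o ∷ u) = hCount (just o) + #H u

#H-replicate-V-++ : ∀ j u → #H (replicate j V ++ u) ≡ #H u
#H-replicate-V-++ zero    u = refl
#H-replicate-V-++ (suc j) u = #H-replicate-V-++ j u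

countHcol-tabulate : ∀ m f → countHcol (tabulate {n = m} (f ∘ toℕ)) ≡ sumBelow m (hCount ∘ f)
countHcol-tabulate zero    f = refl
countHcol-tabulate (suc m) f with f 0
... | just H  = cong suc (countHcol-tabulate m (f ∘ suc))
... | just V  = countHcol-tabulate m (f ∘ suc)
... | nothing = countHcol-tabulate m (f ∘ suc)

sumBelow-splice : ∀ m {m′} (h : Maybe Ori → ℕ) f g →
                  sumBelow (m + m′) (h ∘ splice m f g) ≡ sumBelow m (h ∘ f) + sumBelow m′ (h ∘ g)
sumBelow-splice zero    h f g = refl
sumBelow-splice (suc m) h f g =
  trans (cong (h (f 0) +_) (sumBelow-splice m h (f ∘ suc) g)) (sym (+-assoc (h (f 0)) _ _))

sumBelow-fill : ∀ m a → sumBelow m (hCount ∘ fill m a) ≡ m * hCount a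
sumBelow-fill zero    a = refl
sumBelow-fill (suc m) a = cong (hCount a +_) (sumBelow-fill m a)

sumBelow-shiftʳ : ∀ m r → sumBelow m (hCount ∘ shiftʳ m r) ≡ 0
sumBelow-shiftʳ zero    r = refl
sumBelow-shiftʳ (suc m) r = sumBelow-shiftʳ m r

module Tilings (k-1 : ℕ) where

  k : ℕ
  k = suc k-1

  0<width : ∀ o → 0 < width k o
  0<width H = s≤s z≤n
  0<width V = s≤s z≤n

  0<height : ∀ o → 0 < height k o
  0<height H = s≤s z≤n
  0<height V = s≤s z≤n

  infixr 5 _◃_

  _◃_ : Ori → Row → Row
  (o ◃ r) zero    = just o
  (o ◃ r) (suc x) = shiftʳ (width k o) r (suc x)

  ◃-+ : ∀ o r x → (o ◃ r) (width k o + x) ≡ r x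
  ◃-+ H r x = shiftʳ-+ k-1 r x
  ◃-+ V r x = refl

  ◃-interior : ∀ o r {x} → 0 < x → x < width k o → (o ◃ r) x ≡ nothing
  ◃-interior o r {suc x} _ x<w = shiftʳ-< (width k o) r x<w

  ◃-just : ∀ o r x {o′} → (o ◃ r) x ≡ just o′ →
           (x ≡ 0 × o ≡ o′) ⊎ Σ ℕ λ z → x ≡ width k o + z × r z ≡ just o′
  ◃-just o r zero    refl = inj₁ (refl , refl)
  ◃-just o r (suc x) eq   = inj₂ (shiftʳ-just (width k o) r (suc x) eq)

  ◃-cong : ∀ o {r r′} → r ≗ r′ → o ◃ r ≗ o ◃ r′
  ◃-cong o r≗r′ zero    = refl
  ◃-cong o r≗r′ (suc x) = shiftʳ-cong (width k o) r≗r′ (suc x)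

  rowOf : Word → Row
  rowOf []      _ = nothing
  rowOf (o ∷ u)   = o ◃ rowOf u

  wordWidth : Word → ℕ
  wordWidth []      = 0
  wordWidth (o ∷ u) = width k o + wordWidth u

  -- The first argument is fuel: reading a row tiling of length n needs at least n.
  mutual
    readWord : ℕ → Row → Word
    readWord zero    r = []
    readWord (suc f) r = readWordFrom f r (r 0)

    readWordFrom : ℕ → Row → Maybe Ori → Word
    readWordFrom f r nothing  = []
    readWordFrom f r (just o) = o ∷ readWord f (shiftˡ (width k o) r)

  mutual
    readWord-cong : ∀ f {r r′} → r ≗ r′ → readWord f r ≡ readWord f r′
    readWord-cong zero    r≗r′ = refl
    readWord-cong (suc f) {r} {r′} r≗r′ =
      trans (cong (readWordFrom f r) (r≗r′ 0)) (readWordFrom-cong f r≗r′ (r′ 0))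

    readWordFrom-cong : ∀ f {r r′} → r ≗ r′ → ∀ a → readWordFrom f r a ≡ readWordFrom f r′ a
    readWordFrom-cong f r≗r′ nothing  = refl
    readWordFrom-cong f r≗r′ (just o) = cong (o ∷_) (readWord-cong f (r≗r′ ∘ (width k o +_)))

  readWord-rowOf : ∀ f u → wordWidth u ≤ f → readWord f (rowOf u) ≡ u
  readWord-rowOf zero    []      _  = refl
  readWord-rowOf (suc f) []      _  = refl
  readWord-rowOf zero    (H ∷ u) ()
  readWord-rowOf zero    (V ∷ u) ()
  readWord-rowOf (suc f) (o ∷ u) o∷u≤1+f = cong (o ∷_) (begin
    readWord f (shiftˡ (width k o) (rowOf (o ∷ u))) ≡⟨ readWord-cong f (◃-+ o (rowOf u)) ⟩
    readWord f (rowOf u)                            ≡⟨ readWord-rowOf f u u≤f ⟩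
    u                                               ∎)
    where
    open ≡-Reasoning
    u≤f : wordWidth u ≤ f
    u≤f = ≤-pred (≤-trans (+-monoˡ-≤ (wordWidth u) (0<width o)) o∷u≤1+f)

  RowCovers : Row → ℕ → ℕ → Set
  RowCovers r x′ x = Σ Ori λ o → r x′ ≡ just o × x′ ≤ x × x < x′ + width k o

  record IsRowTiling (r : Row) (n : ℕ) : Set where
    field
      fits    : ∀ x {o} → r x ≡ just o → x + width k o ≤ n
      covered : ∀ x → x < n → Σ ℕ λ x′ → RowCovers r x′ x
      unique  : ∀ {x x₁ x₂} → RowCovers r x₁ x → RowCovers r x₂ x → x₁ ≡ x₂

  rowCovers-self : ∀ r x {o} → r x ≡ just o → RowCovers r x x
  rowCovers-self r x {o} rx≡o = o , rx≡o , ≤-refl , m<m+n x (0<width o)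

  rowCovers-cong : ∀ {r r′ x′ x} → r ≗ r′ → RowCovers r x′ x → RowCovers r′ x′ x
  rowCovers-cong {x′ = x′} r≗r′ (o , eq , cover) = o , trans (sym (r≗r′ x′)) eq , cover

  rowCovers-shiftˡ : ∀ m r {z y} → RowCovers (shiftˡ m r) z y → RowCovers r (m + z) (m + y)
  rowCovers-shiftˡ m r {z} {y} (o , eq , z≤y , y<z+w) =
    o , eq , +-monoʳ-≤ m z≤y , subst (m + y <_) (sym (+-assoc m z _)) (+-monoʳ-< m y<z+w)

  rowCovers-unshiftˡ : ∀ m r {z y} → RowCovers r (m + z) (m + y) → RowCovers (shiftˡ m r) z y
  rowCovers-unshiftˡ m r {z} {y} (o , eq , le , lt) =
    o , eq , +-cancelˡ-≤ m _ _ le , +-cancelˡ-< m _ _ (subst (m + y <_) (+-assoc m z _) lt)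

  isRowTiling-cong : ∀ {r r′ n} → r ≗ r′ → IsRowTiling r n → IsRowTiling r′ n
  isRowTiling-cong r≗r′ T = record
    { fits    = λ x eq → fits x (trans (r≗r′ x) eq)
    ; covered = λ x x<n → let x′ , cover = covered x x<n in x′ , rowCovers-cong r≗r′ cover
    ; unique  = λ c₁ c₂ → unique (rowCovers-cong (sym ∘ r≗r′) c₁) (rowCovers-cong (sym ∘ r≗r′) c₂)
    }
    where open IsRowTiling T

  ◃-covers-below : ∀ o r {x₁ x} → x < width k o → RowCovers (o ◃ r) x₁ x → x₁ ≡ 0
  ◃-covers-below o r {x₁} x<w (_ , eq , x₁≤x , _) with ◃-just o r x₁ eq
  ... | inj₁ (x₁≡0 , _)     = x₁≡0
  ... | inj₂ (z , refl , _) = ⊥-elim (m+n≮m (width k o) z (≤-<-trans x₁≤x x<w))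

  ◃-covers-above : ∀ o r {x₁} y → RowCovers (o ◃ r) x₁ (width k o + y) → Σ ℕ λ z → x₁ ≡ width k o + z
  ◃-covers-above o r {x₁} y (_ , eq , _ , x<x₁+w) with ◃-just o r x₁ eq
  ... | inj₁ (refl , refl) = ⊥-elim (m+n≮m (width k o) y x<x₁+w)
  ... | inj₂ (z , x₁≡ , _) = z , x₁≡

  ◃-isRowTiling : ∀ o {r n} → IsRowTiling r n → IsRowTiling (o ◃ r) (width k o + n)
  ◃-isRowTiling o {r} {n} T = record { fits = fits′ ; covered = covered′ ; unique = unique′ }
    where
    open IsRowTiling T
    w = width k o
    shiftˡ-◃ : shiftˡ w (o ◃ r) ≗ r
    shiftˡ-◃ = ◃-+ o r

    fits′ : ∀ x {o′} → (o ◃ r) x ≡ just o′ → x + width k o′ ≤ w + n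
    fits′ x eq with ◃-just o r x eq
    ... | inj₁ (refl , refl)       = m≤m+n w n
    ... | inj₂ (z , refl , rz≡o′) = subst (_≤ w + n) (sym (+-assoc w z _)) (+-monoʳ-≤ w (fits z rz≡o′))

    covered′ : ∀ x → x < w + n → Σ ℕ λ x′ → RowCovers (o ◃ r) x′ x
    covered′ x x<w+n with split w x
    ... | below x<w = 0 , o , refl , z≤n , x<w
    ... | above y with covered y (+-cancelˡ-< w _ _ x<w+n)
    ...   | z , cover = w + z , rowCovers-shiftˡ w (o ◃ r) (rowCovers-cong (sym ∘ shiftˡ-◃) cover)

    unique′ : ∀ {x x₁ x₂} → RowCovers (o ◃ r) x₁ x → RowCovers (o ◃ r) x₂ x → x₁ ≡ x₂
    unique′ {x} c₁ c₂ with split w x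
    ... | below x<w = trans (◃-covers-below o r x<w c₁) (sym (◃-covers-below o r x<w c₂))
    ... | above y with ◃-covers-above o r y c₁ | ◃-covers-above o r y c₂
    ...   | z₁ , refl | z₂ , refl =
      cong (w +_) (unique (rowCovers-cong shiftˡ-◃ (rowCovers-unshiftˡ w (o ◃ r) c₁))
                          (rowCovers-cong shiftˡ-◃ (rowCovers-unshiftˡ w (o ◃ r) c₂)))

  rowOf-isRowTiling : ∀ u → IsRowTiling (rowOf u) (wordWidth u)
  rowOf-isRowTiling []      = record { fits = λ _ () ; covered = λ _ () ; unique = λ { (_ , () , _) _ } }
  rowOf-isRowTiling (o ∷ u) = ◃-isRowTiling o (rowOf-isRowTiling u)

  module _ {r n} (T : IsRowTiling r n) where
    open IsRowTiling T

    isRowTiling-beyond : ∀ {x} → n ≤ x → r x ≡ nothing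
    isRowTiling-beyond {x} n≤x with r x in eq
    ... | nothing = refl
    ... | just o  = ⊥-elim (<-irrefl refl (<-≤-trans (m<m+n x (0<width o)) (≤-trans (fits x eq) n≤x)))

    isRowTiling-first : ∀ {o x o′} → r 0 ≡ just o → x < width k o → r x ≡ just o′ → x ≡ 0
    isRowTiling-first {o} r0≡o x<w rx≡o′ = sym (unique (o , r0≡o , z≤n , x<w) (rowCovers-self r _ rx≡o′))

    isRowTiling-◃ : ∀ {o} → r 0 ≡ just o → r ≗ o ◃ shiftˡ (width k o) r
    isRowTiling-◃ {o} r0≡o x with split (width k o) x
    ... | below x<w = firstTile x x<w
      where
      firstTile : ∀ x → x < width k o → r x ≡ (o ◃ shiftˡ (width k o) r) x
      firstTile zero    _   = r0≡o
      firstTile (suc x) x<w with r (suc x) in eq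
      ... | nothing = sym (◃-interior o _ (s≤s z≤n) x<w)
      ... | just _  with () ← isRowTiling-first r0≡o x<w eq
    ... | above y = sym (◃-+ o (shiftˡ (width k o) r) y)

    shiftˡ-isRowTiling : ∀ {o} → r 0 ≡ just o → IsRowTiling (shiftˡ (width k o) r) (n ∸ width k o)
    shiftˡ-isRowTiling {o} r0≡o = record { fits = fits′ ; covered = covered′ ; unique = unique′ }
      where
      w = width k o
      w≤n : w ≤ n
      w≤n = fits 0 r0≡o

      fits′ : ∀ x {o′} → r (w + x) ≡ just o′ → x + width k o′ ≤ n ∸ w
      fits′ x eq = m+n≤o⇒m≤o∸n (x + _) (subst (_≤ n) (trans (+-assoc w x _) (+-comm w _)) (fits (w + x) eq))

      covered′ : ∀ x → x < n ∸ w → Σ ℕ λ x′ → RowCovers (shiftˡ w r) x′ x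
      covered′ x x<n∸w with covered (w + x) (subst (w + x <_) (m+[n∸m]≡n w≤n) (+-monoʳ-< w x<n∸w))
      ... | x′ , cover@(o′ , eq , _ , w+x<x′+w′) with split w x′
      ...   | above z   = z , rowCovers-unshiftˡ w r cover
      ...   | below x′<w with isRowTiling-first r0≡o x′<w eq
      ...     | refl with trans (sym r0≡o) eq
      ...       | refl = ⊥-elim (m+n≮m w x w+x<x′+w′)

      unique′ : ∀ {x x₁ x₂} → RowCovers (shiftˡ w r) x₁ x → RowCovers (shiftˡ w r) x₂ x → x₁ ≡ x₂
      unique′ c₁ c₂ = +-cancelˡ-≡ w _ _ (unique (rowCovers-shiftˡ w r c₁) (rowCovers-shiftˡ w r c₂))

  readWord-nothing : ∀ f r → r 0 ≡ nothing → readWord f r ≡ []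
  readWord-nothing zero    r _    = refl
  readWord-nothing (suc f) r r0≡ rewrite r0≡ = refl

  readWord-just : ∀ f r {o} → r 0 ≡ just o → readWord (suc f) r ≡ o ∷ readWord f (shiftˡ (width k o) r)
  readWord-just f r r0≡o rewrite r0≡o = refl

  rowOf-readWord : ∀ f {r n} → IsRowTiling r n → n ≤ f →
                   wordWidth (readWord f r) ≡ n × rowOf (readWord f r) ≗ r
  rowOf-readWord f {r} {zero} T _ rewrite readWord-nothing f r (isRowTiling-beyond T z≤n) =
    refl , λ _ → sym (isRowTiling-beyond T z≤n)
  rowOf-readWord (suc f) {r} {suc n} T (s≤s n≤f) with IsRowTiling.covered T 0 (s≤s z≤n)
  ... | .0 , o , r0≡o , z≤n , _ rewrite readWord-just f r r0≡o =
    trans (cong (w +_) (proj₁ IH)) (m+[n∸m]≡n (IsRowTiling.fits T 0 r0≡o)) ,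
    λ x → trans (◃-cong o (proj₂ IH) x) (sym (isRowTiling-◃ T r0≡o x))
    where
    w = width k o
    IH = rowOf-readWord f (shiftˡ-isRowTiling T r0≡o) (≤-trans (∸-monoʳ-≤ (suc n) (0<width o)) n≤f)

  data Breakpoint : Word → ℕ → Set where
    start : ∀ {u} → Breakpoint u 0
    after : ∀ {o u c} → Breakpoint u c → Breakpoint (o ∷ u) (width k o + c)

  Uncrossed : Row → ℕ → Set
  Uncrossed r c = ∀ x {o} → r x ≡ just o → ¬ (x < c × c < x + width k o)

  breakpoint⇒uncrossed : ∀ {u c} → Breakpoint u c → Uncrossed (rowOf u) c
  breakpoint⇒uncrossed start x _ (() , _)
  breakpoint⇒uncrossed (after {o} {u} {c} bp) x eq (x<w+c , w+c<x+w′) with ◃-just o (rowOf u) x eq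
  ... | inj₁ (refl , refl)     = m+n≮m (width k o) c w+c<x+w′
  ... | inj₂ (z , refl , rz≡) =
    breakpoint⇒uncrossed bp z rz≡
      (+-cancelˡ-< (width k o) _ _ x<w+c ,
       +-cancelˡ-< (width k o) _ _ (subst (width k o + c <_) (+-assoc (width k o) z _) w+c<x+w′))

  uncrossed-first : ∀ {o r c} → c < width k o → Uncrossed (o ◃ r) c → c ≡ 0
  uncrossed-first {c = zero}  _   _   = refl
  uncrossed-first {c = suc c} c<w unc = ⊥-elim (unc 0 refl (s≤s z≤n , c<w))

  uncrossed⇒breakpoint : ∀ u {c} → c ≤ wordWidth u → Uncrossed (rowOf u) c → Breakpoint u c
  uncrossed⇒breakpoint []      z≤n _ = start
  uncrossed⇒breakpoint (o ∷ u) {c} c≤ unc with split (width k o) c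
  ... | below c<w rewrite uncrossed-first c<w unc = start
  ... | above y   = after (uncrossed⇒breakpoint u (+-cancelˡ-≤ (width k o) _ _ c≤) unc′)
    where
    unc′ : Uncrossed (rowOf u) y
    unc′ x eq (x<y , y<x+w′) =
      unc (width k o + x) (trans (◃-+ o (rowOf u) x) eq)
          (+-monoʳ-< (width k o) x<y ,
           subst (width k o + y <_) (sym (+-assoc (width k o) x _)) (+-monoʳ-< (width k o) y<x+w′))

  -- Tilings with a horizontal fault at y = k

  -- For A = anchorAt k g the next four notions unfold to IsTiling k n g,
  -- HorizontalFaultAt k g c, VerticalFaultAt k g c and VerticallyFaultFree k n g.
  Coversᴬ : Anchors → ℕ × ℕ → ℕ × ℕ → Set
  Coversᴬ A (x′ , y′) (x , y) =
    Σ Ori λ o → A x′ y′ ≡ just o × x′ ≤ x × x < x′ + width k o × y′ ≤ y × y < y′ + height k o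

  IsTilingᴬ : Anchors → ℕ → Set
  IsTilingᴬ A n =
      (∀ x y o → A x y ≡ just o → x + width k o ≤ n × y + height k o ≤ 2 * k)
    × (∀ x y → x < n → y < 2 * k → Σ (ℕ × ℕ) λ p → Coversᴬ A p (x , y))
    × (∀ x y p q → Coversᴬ A p (x , y) → Coversᴬ A q (x , y) → p ≡ q)

  HorizontalFaultᴬ : Anchors → ℕ → Set
  HorizontalFaultᴬ A c = ∀ x y o → A x y ≡ just o → ¬ (y < c × c < y + height k o)

  VerticalFaultᴬ : Anchors → ℕ → Set
  VerticalFaultᴬ A c = ∀ x y o → A x y ≡ just o → ¬ (x < c × c < x + width k o)

  VerticallyFaultFreeᴬ : Anchors → ℕ → Set
  VerticallyFaultFreeᴬ A n = ∀ c → 0 < c → c < n → ¬ VerticalFaultᴬ A c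

  coversᴬ-self : ∀ A x y {o} → A x y ≡ just o → Coversᴬ A (x , y) (x , y)
  coversᴬ-self A x y {o} eq = o , eq , ≤-refl , m<m+n x (0<width o) , ≤-refl , m<m+n y (0<height o)

  data Band : ℕ → Set where
    lower : Band 0
    upper : Band k

  InBand : ℕ → ℕ → Set
  InBand b y = b ≤ y × y < b + k

  band-top : ∀ {b} → Band b → b + k ≤ 2 * k
  band-top lower = m≤m+n k (k + 0)
  band-top upper = ≤-reflexive (cong (k +_) (sym (+-identityʳ k)))

  band-unique : ∀ {b₁ b₂ y} → Band b₁ → Band b₂ → InBand b₁ y → InBand b₂ y → b₁ ≡ b₂
  band-unique lower lower _         _         = refl
  band-unique upper upper _         _         = refl
  band-unique lower upper (_ , y<k) (k≤y , _) = ⊥-elim (<⇒≱ y<k k≤y)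
  band-unique upper lower (k≤y , _) (_ , y<k) = ⊥-elim (<⇒≱ y<k k≤y)

  bandOf : ∀ {y} → y < 2 * k → Σ ℕ λ b → Band b × InBand b y
  bandOf {y} y<2k with split k y
  ... | below y<k = 0 , lower , z≤n , y<k
  ... | above z   = k , upper , m≤m+n k z , subst (k + z <_) (cong (k +_) (+-identityʳ k)) y<2k

  anchorRow : Ori → ℕ → ℕ → ℕ
  anchorRow H b y = y
  anchorRow V b y = b

  anchorRow-covers : ∀ o {b y} → InBand b y → anchorRow o b y ≤ y × y < anchorRow o b y + height k o
  anchorRow-covers H {y = y} _ = ≤-refl , m<m+n y (s≤s z≤n)
  anchorRow-covers V inBand    = inBand

  bandColumn : Maybe Ori → Row
  bandColumn a zero    = a
  bandColumn a (suc y) = fill k-1 (aboveBase a) y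

  column : Maybe Ori → Maybe Ori → Row
  column a c = splice k (bandColumn a) (bandColumn c)

  stack : Row → Row → Anchors
  stack r₀ r₁ x = column (r₀ x) (r₁ x)

  bandColumn-interior : ∀ a {y} → 0 < y → y < k → bandColumn a y ≡ aboveBase a
  bandColumn-interior a {suc y} _ (s≤s y<k-1) = fill-< k-1 (aboveBase a) y<k-1

  bandColumn-beyond : ∀ a {y} → k ≤ y → bandColumn a y ≡ nothing
  bandColumn-beyond a {suc y} (s≤s k-1≤y) = fill-≥ k-1 (aboveBase a) k-1≤y

  bandColumn-H : ∀ {y} → y < k → bandColumn (just H) y ≡ just H
  bandColumn-H {zero}  _           = refl
  bandColumn-H {suc y} (s≤s y<k-1) = fill-< k-1 (just H) y<k-1

  bandColumn-just : ∀ a y {o} → bandColumn a y ≡ just o →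
                    (y ≡ 0 × a ≡ just o) ⊎ (y < k × o ≡ H × a ≡ just H)
  bandColumn-just a zero    eq = inj₁ (refl , eq)
  bandColumn-just a (suc y) eq with fill-just k-1 (aboveBase a) y eq
  ... | y<k-1 , eq′ with aboveBase-just a eq′
  ...   | refl , a≡H = inj₂ (s≤s y<k-1 , refl , a≡H)

  column-lower : ∀ a c {y} → y < k → column a c y ≡ bandColumn a y
  column-lower a c = splice-< k (bandColumn a) (bandColumn c)

  column-upper : ∀ a c z → column a c (k + z) ≡ bandColumn c z
  column-upper a c = splice-+ k (bandColumn a) (bandColumn c)

  column-k : ∀ a c → column a c k ≡ c
  column-k a c = trans (cong (column a c) (sym (+-identityʳ k))) (column-upper a c 0)

  column-beyond : ∀ a c {y} → 2 * k ≤ y → column a c y ≡ nothing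
  column-beyond a c {y} 2k≤y with split k y
  ... | below y<k = ⊥-elim (<⇒≱ y<k (≤-trans (m≤m+n k _) 2k≤y))
  ... | above z   = trans (column-upper a c z)
                          (bandColumn-beyond c (+-cancelˡ-≤ k _ _
                             (subst (_≤ k + z) (cong (k +_) (+-identityʳ k)) 2k≤y)))

  bandColumn-nothing : ∀ y → bandColumn nothing y ≡ nothing
  bandColumn-nothing zero    = refl
  bandColumn-nothing (suc y) = fill-nothing k-1 y

  column-nothing : ∀ y → column nothing nothing y ≡ nothing
  column-nothing y with split k y
  ... | below y<k = trans (column-lower nothing nothing y<k) (bandColumn-nothing y)
  ... | above z   = trans (column-upper nothing nothing z) (bandColumn-nothing z)

  anchor-top : ∀ {b y o} → InBand b y → (o ≡ V → y ≡ b) → y + height k o ≤ b + k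
  anchor-top {b} {y} {H} (_ , y<b+k) _   = subst (_≤ b + k) (+-comm 1 y) y<b+k
  anchor-top {o = V}    _           V⇒b = ≤-reflexive (cong (_+ k) (V⇒b refl))

  anchorRow-unique : ∀ o {b y₁ y} → y₁ ≤ y → y < y₁ + height k o → (o ≡ V → y₁ ≡ b) → y₁ ≡ anchorRow o b y
  anchorRow-unique H y₁≤y y<y₁+1 _   = ≤∧<+1⇒≡ y₁≤y y<y₁+1
  anchorRow-unique V _    _      V⇒b = V⇒b refl

  -- The shape forced by a horizontal fault at k: each band column holds a vertical tile
  -- at its base, k horizontal tiles, or no anchor.
  record Banded (A : Anchors) : Set where
    field
      anchored : ∀ x y {o} → A x y ≡ just o →
                 Σ ℕ λ b → Band b × InBand b y × A x b ≡ just o × (o ≡ V → y ≡ b)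
      filled   : ∀ x {b y} → Band b → InBand b y → A x b ≡ just H → A x y ≡ just H

  banded-cong : ∀ {A A′} → (∀ x → A x ≗ A′ x) → Banded A → Banded A′
  banded-cong {A} {A′} A≗A′ B = record { anchored = anchored′ ; filled = filled′ }
    where
    open Banded B
    anchored′ : ∀ x y {o} → A′ x y ≡ just o →
                Σ ℕ λ b → Band b × InBand b y × A′ x b ≡ just o × (o ≡ V → y ≡ b)
    anchored′ x y eq with anchored x y (trans (A≗A′ x y) eq)
    ... | b , band , inBand , eqb , V⇒b = b , band , inBand , trans (sym (A≗A′ x b)) eqb , V⇒b
    filled′ : ∀ x {b y} → Band b → InBand b y → A′ x b ≡ just H → A′ x y ≡ just H
    filled′ x band inBand eq = trans (sym (A≗A′ x _)) (filled x band inBand (trans (A≗A′ x _) eq))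

  stack-banded : ∀ r₀ r₁ → Banded (stack r₀ r₁)
  stack-banded r₀ r₁ = record { anchored = anchored ; filled = filled }
    where
    anchored : ∀ x y {o} → stack r₀ r₁ x y ≡ just o →
               Σ ℕ λ b → Band b × InBand b y × stack r₀ r₁ x b ≡ just o × (o ≡ V → y ≡ b)
    anchored x y eq with split k y
    ... | below y<k with bandColumn-just (r₀ x) y (trans (sym (column-lower _ _ y<k)) eq)
    ...   | inj₁ (refl , eq₀)       = 0 , lower , (z≤n , y<k) , eq₀ , λ _ → refl
    ...   | inj₂ (_ , refl , eq₀)   = 0 , lower , (z≤n , y<k) , eq₀ , λ ()
    anchored x y eq | above z with bandColumn-just (r₁ x) z (trans (sym (column-upper _ _ z)) eq)
    ...   | inj₁ (refl , eq₁)       = k , upper , (m≤m+n k 0 , +-monoʳ-< k (s≤s z≤n)) ,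
                                      trans (column-k _ _) eq₁ , λ _ → +-identityʳ k
    ...   | inj₂ (z<k , refl , eq₁) = k , upper , (m≤m+n k z , +-monoʳ-< k z<k) ,
                                      trans (column-k _ _) eq₁ , λ ()
    filled : ∀ x {b y} → Band b → InBand b y → stack r₀ r₁ x b ≡ just H → stack r₀ r₁ x y ≡ just H
    filled x {y = y} lower (_ , y<k) eq =
      trans (column-lower _ _ y<k) (subst (λ a → bandColumn a y ≡ just H) (sym eq) (bandColumn-H y<k))
    filled x {y = y} upper (k≤y , y<2k) eq with split k y
    ... | below y<k = ⊥-elim (<⇒≱ y<k k≤y)
    ... | above z   =
      trans (column-upper _ _ z)
            (subst (λ a → bandColumn a z ≡ just H) (sym (trans (sym (column-k _ _)) eq))
                   (bandColumn-H (+-cancelˡ-< k _ _ y<2k)))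

  module _ {A} (B : Banded A) where
    open Banded B

    banded-interior : ∀ {x y b} → Band b → b < y → y < b + k → A x y ≡ aboveBase (A x b)
    banded-interior {x} {y} {b} band b<y y<b+k with A x y in eqy
    ... | just o with anchored x y eqy
    ...   | b′ , band′ , inBand′ , eqb , V⇒b with band-unique band′ band inBand′ (<⇒≤ b<y , y<b+k)
    ...     | refl with o
    ...       | H = sym (cong aboveBase eqb)
    ...       | V = ⊥-elim (<-irrefl (sym (V⇒b refl)) b<y)
    banded-interior {x} {y} {b} band b<y y<b+k | nothing with A x b in eqb
    ... | just H  with () ← trans (sym eqy) (filled x band (<⇒≤ b<y , y<b+k) eqb)
    ... | just V  = refl
    ... | nothing = refl

    banded-beyond : ∀ {x y} → 2 * k ≤ y → A x y ≡ nothing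
    banded-beyond {x} {y} 2k≤y with A x y in eq
    ... | nothing = refl
    ... | just o with anchored x y eq
    ...   | b , band , (_ , y<b+k) , _ = ⊥-elim (<⇒≱ (<-≤-trans y<b+k (band-top band)) 2k≤y)

    banded-column : ∀ x → A x ≗ column (A x 0) (A x k)
    banded-column x y with split k y
    ... | below y<k = trans (lowerBand y y<k) (sym (column-lower _ _ y<k))
      where
      lowerBand : ∀ y → y < k → A x y ≡ bandColumn (A x 0) y
      lowerBand zero    _   = refl
      lowerBand (suc y) y<k =
        trans (banded-interior lower (s≤s z≤n) y<k) (sym (bandColumn-interior _ (s≤s z≤n) y<k))
    ... | above z = trans (upperBand z) (sym (column-upper _ _ z))
      where
      upperBand : ∀ z → A x (k + z) ≡ bandColumn (A x k) z
      upperBand zero = cong (A x) (+-identityʳ k)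
      upperBand (suc z) with suc z <? k
      ... | yes z<k = trans (banded-interior upper (m<m+n k (s≤s z≤n)) (+-monoʳ-< k z<k))
                            (sym (bandColumn-interior _ (s≤s z≤n) z<k))
      ... | no  z≮k = trans (banded-beyond (subst (_≤ k + suc z) (cong (k +_) (sym (+-identityʳ k)))
                                                  (+-monoʳ-≤ k (≮⇒≥ z≮k))))
                            (sym (bandColumn-beyond _ (≮⇒≥ z≮k)))

    banded-horizontalFault : HorizontalFaultᴬ A k
    banded-horizontalFault x y H eq (y<k , k<y+1) = <⇒≱ k<y+1 (subst (_≤ k) (+-comm 1 y) y<k)
    banded-horizontalFault x y V eq (y<k , k<y+k) with anchored x y eq
    ... | b , band , _ , _ , V⇒b with V⇒b refl | band
    ...   | refl | lower = n≮n k k<y+k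
    ...   | refl | upper = n≮n k y<k

    anchorRow-anchor : ∀ {x b y o} → Band b → InBand b y → A x b ≡ just o → A x (anchorRow o b y) ≡ just o
    anchorRow-anchor {o = H} band inBand eq = filled _ band inBand eq
    anchorRow-anchor {o = V} _    _      eq = eq

    cover-in-band : ∀ {x₁ y₁ x y} → Coversᴬ A (x₁ , y₁) (x , y) →
                    Σ ℕ λ b → Band b × InBand b y ×
                      Σ (RowCovers (λ x → A x b) x₁ x) λ cover → y₁ ≡ anchorRow (proj₁ cover) b y
    cover-in-band {x₁} {y₁} (o , eq , x₁≤x , x<x₁+w , y₁≤y , y<y₁+h) with anchored x₁ y₁ eq
    ... | b , band , inBand₁ , eqb , V⇒b =
      b , band , (≤-trans (proj₁ inBand₁) y₁≤y , <-≤-trans y<y₁+h (anchor-top inBand₁ V⇒b)) ,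
      (o , eqb , x₁≤x , x<x₁+w) , anchorRow-unique o y₁≤y y<y₁+h V⇒b

    banded-tiling : ∀ {n} → IsRowTiling (λ x → A x 0) n → IsRowTiling (λ x → A x k) n → IsTilingᴬ A n
    banded-tiling {n} T₀ Tₖ = fits , covered , unique
      where
      row : ∀ {b} → Band b → IsRowTiling (λ x → A x b) n
      row lower = T₀
      row upper = Tₖ

      fits : ∀ x y o → A x y ≡ just o → x + width k o ≤ n × y + height k o ≤ 2 * k
      fits x y o eq with anchored x y eq
      ... | b , band , inBand , eqb , V⇒b =
        IsRowTiling.fits (row band) x eqb , ≤-trans (anchor-top inBand V⇒b) (band-top band)

      covered : ∀ x y → x < n → y < 2 * k → Σ (ℕ × ℕ) λ p → Coversᴬ A p (x , y)
      covered x y x<n y<2k with bandOf y<2k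
      ... | b , band , inBand with IsRowTiling.covered (row band) x x<n
      ...   | x′ , o , eq , x′≤x , x<x′+w =
        (x′ , anchorRow o b y) , o , anchorRow-anchor band inBand eq , x′≤x , x<x′+w , anchorRow-covers o inBand

      unique : ∀ x y p q → Coversᴬ A p (x , y) → Coversᴬ A q (x , y) → p ≡ q
      unique x y (x₁ , _) _ c₁ c₂ with cover-in-band c₁ | cover-in-band c₂
      ... | _ , band₁ , inBand₁ , rc₁ , y₁≡ | _ , band₂ , inBand₂ , rc₂ , y₂≡
        with band-unique band₁ band₂ inBand₁ inBand₂
      ... | refl with IsRowTiling.unique (row band₁) rc₁ rc₂
      ... | refl with Maybe.just-injective (trans (sym (proj₁ (proj₂ rc₁))) (proj₁ (proj₂ rc₂)))
      ... | refl = cong (x₁ ,_) (trans y₁≡ (sym y₂≡))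

  module _ {A n} (T : IsTilingᴬ A n) (hf : HorizontalFaultᴬ A k) where
    private
      fits    = proj₁ T
      covered = proj₁ (proj₂ T)
      unique  = proj₂ (proj₂ T)

      vertical-band : ∀ {x y} → A x y ≡ just V → Band y
      vertical-band {x} {y} eq with split k y
      ... | below y<k = lowerBase y y<k eq
        where
        lowerBase : ∀ y → y < k → A x y ≡ just V → Band y
        lowerBase zero    _   _  = lower
        lowerBase (suc y) y<k eq = ⊥-elim (hf x (suc y) V eq (y<k , m<n+m k (s≤s z≤n)))
      ... | above z = subst Band (sym (trans (cong (k +_) z≡0) (+-identityʳ k))) upper
        where
        z+k≤k : z + k ≤ k
        z+k≤k = subst (z + k ≤_) (+-identityʳ k)
                  (+-cancelˡ-≤ k _ _ (subst (_≤ 2 * k) (+-assoc k z k) (proj₂ (fits x (k + z) V eq))))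
        z≡0 : z ≡ 0
        z≡0 = n≤0⇒n≡0 (+-cancelʳ-≤ k z 0 z+k≤k)

      AlignedAt : ℕ → ℕ → ℕ → Set
      AlignedAt b y x = (A x y ≡ just H → A x b ≡ just H) × (A x b ≡ just H → A x y ≡ just H)

      -- By induction on x: an H anchored left of x in the band would cover cell x.
      aligned : ∀ {b y} → Band b → InBand b y → ∀ x → AlignedAt b y x
      aligned {b} {y} band inBand@(b≤y , y<b+k) = <-rec (AlignedAt b y) λ x IH → up x IH , down x IH
        where
        b∈b : InBand b b
        b∈b = ≤-refl , m<m+n b (s≤s z≤n)

        H⇒x<n : ∀ {x c} → A x c ≡ just H → x < n
        H⇒x<n {x} {c} eq = <-≤-trans (m<m+n x (s≤s z≤n)) (proj₁ (fits x c H eq))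

        <2k : ∀ {c} → InBand b c → c < 2 * k
        <2k (_ , c<b+k) = <-≤-trans c<b+k (band-top band)

        up : ∀ x → (∀ {x′} → x′ < x → AlignedAt b y x′) → A x y ≡ just H → A x b ≡ just H
        up x IH eq with covered x b (H⇒x<n eq) (<2k b∈b)
        ... | (x′ , y′) , V , eq′ , x′≤x , x<x′+1 , y′≤b , b<y′+k
          with ≤∧<+1⇒≡ x′≤x x<x′+1 | band-unique (vertical-band eq′) band (y′≤b , b<y′+k) b∈b
        ... | refl | refl
          with () ← trans (sym eq′) (trans (cong (A x ∘ proj₂)
                      (unique x y (x , b) (x , y) (V , eq′ , ≤-refl , x<x′+1 , b≤y , y<b+k)
                              (coversᴬ-self A x y eq))) eq)
        up x IH eq | (x′ , y′) , H , eq′ , x′≤x , x<x′+k , y′≤b , b<y′+1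
          with ≤∧<+1⇒≡ y′≤b b<y′+1 | m≤n⇒m<n∨m≡n x′≤x
        ... | refl | inj₂ refl = eq′
        ... | refl | inj₁ x′<x =
          ⊥-elim (<-irrefl (cong proj₁ (unique x y (x′ , y) (x , y)
                   (H , proj₂ (IH x′<x) eq′ , x′≤x , x<x′+k , ≤-refl , m<m+n y (s≤s z≤n))
                   (coversᴬ-self A x y eq))) x′<x)

        down : ∀ x → (∀ {x′} → x′ < x → AlignedAt b y x′) → A x b ≡ just H → A x y ≡ just H
        down x IH eq with covered x y (H⇒x<n eq) (<2k inBand)
        ... | (x′ , y′) , V , eq′ , x′≤x , x<x′+1 , y′≤y , y<y′+k
          with ≤∧<+1⇒≡ x′≤x x<x′+1 | band-unique (vertical-band eq′) band (y′≤y , y<y′+k) inBand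
        ... | refl | refl with () ← trans (sym eq′) eq
        down x IH eq | (x′ , y′) , H , eq′ , x′≤x , x<x′+k , y′≤y , y<y′+1
          with ≤∧<+1⇒≡ y′≤y y<y′+1 | m≤n⇒m<n∨m≡n x′≤x
        ... | refl | inj₂ refl = eq′
        ... | refl | inj₁ x′<x =
          ⊥-elim (<-irrefl (cong proj₁ (unique x b (x′ , b) (x , b)
                   (H , proj₁ (IH x′<x) eq′ , x′≤x , x<x′+k , ≤-refl , m<m+n b (s≤s z≤n))
                   (coversᴬ-self A x b eq))) x′<x)

    faulted⇒banded : Banded A
    faulted⇒banded = record { anchored = anchored ; filled = filled }
      where
      anchored : ∀ x y {o} → A x y ≡ just o →
                 Σ ℕ λ b → Band b × InBand b y × A x b ≡ just o × (o ≡ V → y ≡ b)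
      anchored x y {V} eq = y , vertical-band eq , (≤-refl , m<m+n y (s≤s z≤n)) , eq , λ _ → refl
      anchored x y {H} eq with bandOf (subst (_≤ 2 * k) (+-comm y 1) (proj₂ (fits x y H eq)))
      ... | b , band , inBand = b , band , inBand , proj₁ (aligned band inBand x) eq , λ ()
      filled : ∀ x {b y} → Band b → InBand b y → A x b ≡ just H → A x y ≡ just H
      filled x band inBand = proj₂ (aligned band inBand x)

    faulted⇒bandRow : ∀ {b} → Band b → IsRowTiling (λ x → A x b) n
    faulted⇒bandRow {b} band = record { fits = fits′ ; covered = covered′ ; unique = unique′ }
      where
      b∈b : InBand b b
      b∈b = ≤-refl , m<m+n b (s≤s z≤n)

      fits′ : ∀ x {o} → A x b ≡ just o → x + width k o ≤ n
      fits′ x {o} eq = proj₁ (fits x b o eq)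

      covered′ : ∀ x → x < n → Σ ℕ λ x′ → RowCovers (λ x → A x b) x′ x
      covered′ x x<n with covered x b x<n (<-≤-trans (proj₂ b∈b) (band-top band))
      ... | (x′ , y′) , o , eq , x′≤x , x<x′+w , y′≤b , b<y′+h =
        x′ , o , subst (λ c → A x′ c ≡ just o) (y′≡b o eq y′≤b b<y′+h) eq , x′≤x , x<x′+w
        where
        y′≡b : ∀ o {x′ y′} → A x′ y′ ≡ just o → y′ ≤ b → b < y′ + height k o → y′ ≡ b
        y′≡b H _  y′≤b b<y′+1 = ≤∧<+1⇒≡ y′≤b b<y′+1
        y′≡b V eq y′≤b b<y′+k = band-unique (vertical-band eq) band (y′≤b , b<y′+k) b∈b

      unique′ : ∀ {x x₁ x₂} → RowCovers (λ x → A x b) x₁ x → RowCovers (λ x → A x b) x₂ x → x₁ ≡ x₂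
      unique′ {x} c₁ c₂ = cong proj₁ (unique x b _ _ (lift c₁) (lift c₂))
        where
        lift : ∀ {x′} → RowCovers (λ x → A x b) x′ x → Coversᴬ A (x′ , b) (x , b)
        lift (o , eq , x′≤x , x<x′+w) = o , eq , x′≤x , x<x′+w , ≤-refl , m<m+n b (0<height o)

  -- X is placed with its left end at column e of Y.
  CommonBreakpointFree : ℕ → Word → Word → Set
  CommonBreakpointFree e Y X =
    ∀ c → 0 < e + c → e + c < wordWidth Y → Breakpoint Y (e + c) → Breakpoint X c → ⊥

  module _ {A} (B : Banded A) {u w} (A₀≗u : ∀ x → A x 0 ≡ rowOf u x) (Aₖ≗w : ∀ x → A x k ≡ rowOf w x) where
    open Banded B

    faultFree⇒commonBreakpointFree : ∀ {n} → wordWidth u ≡ n → VerticallyFaultFreeᴬ A n →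
                                     CommonBreakpointFree 0 u w
    faultFree⇒commonBreakpointFree u≡n free c 0<c c<u bu bw = free c 0<c (subst (c <_) u≡n c<u) fault
      where
      fault : VerticalFaultᴬ A c
      fault x y o eq crossing with anchored x y eq
      ... | _ , lower , _ , eq₀ , _ = breakpoint⇒uncrossed bu x (trans (sym (A₀≗u x)) eq₀) crossing
      ... | _ , upper , _ , eqₖ , _ = breakpoint⇒uncrossed bw x (trans (sym (Aₖ≗w x)) eqₖ) crossing

    commonBreakpointFree⇒faultFree : ∀ {n} → wordWidth u ≡ n → wordWidth w ≡ n →
                                     CommonBreakpointFree 0 u w → VerticallyFaultFreeᴬ A n
    commonBreakpointFree⇒faultFree refl w≡n free c 0<c c<n fault =
      free c 0<c c<n
        (uncrossed⇒breakpoint u (<⇒≤ c<n) λ x eq → fault x 0 _ (trans (A₀≗u x) eq))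
        (uncrossed⇒breakpoint w (<⇒≤ (subst (c <_) (sym w≡n) c<n)) λ x eq → fault x k _ (trans (Aₖ≗w x) eq))

  gridOf : ∀ n → Anchors → Grid k n
  gridOf n A = tabulate λ i → tabulate λ j → A (toℕ i) (toℕ j)

  gridOf-cong : ∀ n {A A′} → (∀ x → A x ≗ A′ x) → gridOf n A ≡ gridOf n A′
  gridOf-cong n A≗A′ = Vec.tabulate-cong λ i → Vec.tabulate-cong λ j → A≗A′ (toℕ i) (toℕ j)

  gridOf-anchorAt : ∀ n (g : Grid k n) → gridOf n (anchorAt k g) ≡ g
  gridOf-anchorAt n g = trans (Vec.tabulate-cong λ i → tabulate-vat (2 * k) nothing _)
                              (tabulate-vat n (Vec.replicate (2 * k) nothing) g)

  anchorAt-gridOf : ∀ n A → (∀ x y → n ≤ x ⊎ 2 * k ≤ y → A x y ≡ nothing) →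
                    ∀ x → anchorAt k (gridOf n A) x ≗ A x
  anchorAt-gridOf n A outside x y with x <? n
  ... | no x≮n =
    trans (cong (λ col → vat nothing col y) (vat-tabulate-≥ n (λ x → tabulate (A x ∘ toℕ)) _ (≮⇒≥ x≮n)))
          (trans (vat-replicate (2 * k) nothing y) (sym (outside x y (inj₁ (≮⇒≥ x≮n)))))
  ... | yes x<n =
    trans (cong (λ col → vat nothing col y) (vat-tabulate n (λ x → tabulate (A x ∘ toℕ)) _ x<n)) inColumn
    where
    inColumn : vat nothing (tabulate {n = 2 * k} (A x ∘ toℕ)) y ≡ A x y
    inColumn with y <? 2 * k
    ... | yes y<2k = vat-tabulate (2 * k) (A x) nothing y<2k
    ... | no  y≮2k = trans (vat-tabulate-≥ (2 * k) (A x) nothing (≮⇒≥ y≮2k))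
                           (sym (outside x y (inj₂ (≮⇒≥ y≮2k))))

  numH-tabulate : ∀ m (f : ℕ → Vec (Maybe Ori) (2 * k)) →
                  numH k (tabulate {n = m} (f ∘ toℕ)) ≡ sumBelow m (countHcol ∘ f)
  numH-tabulate zero    f = refl
  numH-tabulate (suc m) f = cong (countHcol (f 0) +_) (numH-tabulate m (f ∘ suc))

  numH-gridOf : ∀ n A → numH k (gridOf n A) ≡ sumBelow n (λ x → sumBelow (2 * k) (hCount ∘ A x))
  numH-gridOf n A = trans (numH-tabulate n (λ x → tabulate (A x ∘ toℕ)))
                          (sumBelow-cong n λ x → countHcol-tabulate (2 * k) (A x))

  sumBelow-column : ∀ a c → sumBelow (2 * k) (hCount ∘ column a c) ≡ k * hCount a + k * hCount c
  sumBelow-column a c = begin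
    sumBelow (2 * k) (hCount ∘ column a c)
      ≡⟨ cong (λ m → sumBelow (k + m) (hCount ∘ column a c)) (+-identityʳ k) ⟩
    sumBelow (k + k) (hCount ∘ column a c)
      ≡⟨ sumBelow-splice k hCount (bandColumn a) (bandColumn c) ⟩
    sumBelow k (hCount ∘ bandColumn a) + sumBelow k (hCount ∘ bandColumn c)
      ≡⟨ cong₂ _+_ (sumBelow-bandColumn a) (sumBelow-bandColumn c) ⟩
    k * hCount a + k * hCount c
      ∎
    where
    open ≡-Reasoning
    sumBelow-bandColumn : ∀ a → sumBelow k (hCount ∘ bandColumn a) ≡ k * hCount a
    sumBelow-bandColumn a =
      cong (hCount a +_) (trans (sumBelow-fill k-1 (aboveBase a)) (cong (k-1 *_) (hCount-aboveBase a)))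

  sumBelow-rowOf : ∀ u → sumBelow (wordWidth u) (hCount ∘ rowOf u) ≡ #H u
  sumBelow-rowOf []      = refl
  sumBelow-rowOf (o ∷ u) = begin
    sumBelow (width k o + wordWidth u) (hCount ∘ rowOf (o ∷ u))
      ≡⟨ sumBelow-+ (width k o) (wordWidth u) _ ⟩
    sumBelow (width k o) (hCount ∘ (o ◃ rowOf u)) +
    sumBelow (wordWidth u) (hCount ∘ shiftˡ (width k o) (o ◃ rowOf u))
      ≡⟨ cong₂ _+_ (firstTile o) (trans (sumBelow-cong (wordWidth u) (cong hCount ∘ ◃-+ o (rowOf u)))
                                        (sumBelow-rowOf u)) ⟩
    hCount (just o) + #H u
      ∎
    where
    open ≡-Reasoning
    firstTile : ∀ o → sumBelow (width k o) (hCount ∘ (o ◃ rowOf u)) ≡ hCount (just o)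
    firstTile H = cong suc (sumBelow-shiftʳ k-1 (rowOf u))
    firstTile V = refl

  numH-stack : ∀ {n} u w → wordWidth u ≡ n → wordWidth w ≡ n →
               numH k (gridOf n (stack (rowOf u) (rowOf w))) ≡ k * #H u + k * #H w
  numH-stack {n} u w refl w≡n = begin
    numH k (gridOf n (stack (rowOf u) (rowOf w)))
      ≡⟨ numH-gridOf n (stack (rowOf u) (rowOf w)) ⟩
    sumBelow n (λ x → sumBelow (2 * k) (hCount ∘ column (rowOf u x) (rowOf w x)))
      ≡⟨ sumBelow-cong n (λ x → sumBelow-column (rowOf u x) (rowOf w x)) ⟩
    sumBelow n (λ x → k * hCount (rowOf u x) + k * hCount (rowOf w x))
      ≡⟨ sumBelow-distrib-+ n _ _ ⟩
    sumBelow n (λ x → k * hCount (rowOf u x)) + sumBelow n (λ x → k * hCount (rowOf w x))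
      ≡⟨ cong₂ _+_ (sumBelow-*ˡ n k _) (sumBelow-*ˡ n k _) ⟩
    k * sumBelow n (hCount ∘ rowOf u) + k * sumBelow n (hCount ∘ rowOf w)
      ≡⟨ cong₂ (λ a b → k * a + k * b) (sumBelow-rowOf u)
               (trans (cong (λ m → sumBelow m (hCount ∘ rowOf w)) (sym w≡n)) (sumBelow-rowOf w)) ⟩
    k * #H u + k * #H w
      ∎
    where open ≡-Reasoning

  -- Tilings as pairs of words

  stackedGrid : ∀ n → Word → Word → Grid k n
  stackedGrid n u w = gridOf n (stack (rowOf u) (rowOf w))

  module _ {n} u w (u≡n : wordWidth u ≡ n) (w≡n : wordWidth w ≡ n) where
    private
      A = anchorAt k (stackedGrid n u w)

      rowOf-beyond : ∀ v {x} → wordWidth v ≡ n → n ≤ x → rowOf v x ≡ nothing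
      rowOf-beyond v refl = isRowTiling-beyond (rowOf-isRowTiling v)

      A≗stack : ∀ x → A x ≗ stack (rowOf u) (rowOf w) x
      A≗stack = anchorAt-gridOf n _ outside
        where
        outside : ∀ x y → n ≤ x ⊎ 2 * k ≤ y → stack (rowOf u) (rowOf w) x y ≡ nothing
        outside x y (inj₁ n≤x) rewrite rowOf-beyond u u≡n n≤x | rowOf-beyond w w≡n n≤x = column-nothing y
        outside x y (inj₂ 2k≤y) = column-beyond _ _ 2k≤y

      A₀≗u : ∀ x → A x 0 ≡ rowOf u x
      A₀≗u x = A≗stack x 0

      Aₖ≗w : ∀ x → A x k ≡ rowOf w x
      Aₖ≗w x = trans (A≗stack x k) (column-k _ _)

      B : Banded A
      B = banded-cong (λ x y → sym (A≗stack x y)) (stack-banded (rowOf u) (rowOf w))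

    stackedGrid-isTiling : IsTiling k n (stackedGrid n u w)
    stackedGrid-isTiling = banded-tiling B (row u u≡n (sym ∘ A₀≗u)) (row w w≡n (sym ∘ Aₖ≗w))
      where
      row : ∀ v {r} → wordWidth v ≡ n → rowOf v ≗ r → IsRowTiling r n
      row v refl v≗r = isRowTiling-cong v≗r (rowOf-isRowTiling v)

    stackedGrid-horizontalFault : HorizontalFaultAt k (stackedGrid n u w) k
    stackedGrid-horizontalFault = banded-horizontalFault B

    stackedGrid-faultFree : CommonBreakpointFree 0 u w → VerticallyFaultFree k n (stackedGrid n u w)
    stackedGrid-faultFree = commonBreakpointFree⇒faultFree B A₀≗u Aₖ≗w u≡n w≡n

    readWord-stackedGrid : readWord n (λ x → A x 0) ≡ u × readWord n (λ x → A x k) ≡ w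
    readWord-stackedGrid = trans (readWord-cong n A₀≗u) (readWord-rowOf n u (≤-reflexive u≡n)) ,
                           trans (readWord-cong n Aₖ≗w) (readWord-rowOf n w (≤-reflexive w≡n))

  lowerWordOf upperWordOf : ∀ {n} → Grid k n → Word
  lowerWordOf {n} g = readWord n (λ x → anchorAt k g x 0)
  upperWordOf {n} g = readWord n (λ x → anchorAt k g x k)

  module _ {n} (g : Grid k n) (T : IsTiling k n g) (hf : HorizontalFaultAt k g k) where
    private
      A = anchorAt k g
      B = faulted⇒banded T hf
      lower-read = rowOf-readWord n (faulted⇒bandRow T hf lower) ≤-refl
      upper-read = rowOf-readWord n (faulted⇒bandRow T hf upper) ≤-refl

    lowerWordOf-width : wordWidth (lowerWordOf g) ≡ n
    lowerWordOf-width = proj₁ lower-read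

    upperWordOf-width : wordWidth (upperWordOf g) ≡ n
    upperWordOf-width = proj₁ upper-read

    stackedGrid-wordsOf : stackedGrid n (lowerWordOf g) (upperWordOf g) ≡ g
    stackedGrid-wordsOf = begin
      gridOf n (stack (rowOf (lowerWordOf g)) (rowOf (upperWordOf g)))
        ≡⟨ gridOf-cong n (λ x y → cong₂ (λ a c → column a c y) (proj₂ lower-read x) (proj₂ upper-read x)) ⟩
      gridOf n (λ x → column (A x 0) (A x k))
        ≡⟨ gridOf-cong n (λ x y → sym (banded-column B x y)) ⟩
      gridOf n A
        ≡⟨ gridOf-anchorAt n g ⟩
      g ∎
      where open ≡-Reasoning

    wordsOf-commonBreakpointFree : VerticallyFaultFree k n g →
                                   CommonBreakpointFree 0 (lowerWordOf g) (upperWordOf g)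
    wordsOf-commonBreakpointFree =
      faultFree⇒commonBreakpointFree B (sym ∘ proj₂ lower-read) (sym ∘ proj₂ upper-read) lowerWordOf-width

    wordsOf-weight : ∀ {h} → numH k g ≡ h → k * #H (lowerWordOf g) + k * #H (upperWordOf g) ≡ h
    wordsOf-weight numH≡h = begin
      k * #H (lowerWordOf g) + k * #H (upperWordOf g)
        ≡⟨ numH-stack (lowerWordOf g) (upperWordOf g) lowerWordOf-width upperWordOf-width ⟨
      numH k (stackedGrid n (lowerWordOf g) (upperWordOf g))
        ≡⟨ cong (numH k) stackedGrid-wordsOf ⟩
      numH k g
        ≡⟨ numH≡h ⟩
      _ ∎
      where open ≡-Reasoning

  -- The proof fields are irrelevant, so word pairs with the same words are equal.
  record WordPair (n h : ℕ) : Set where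
    constructor wordPair
    field
      lowerWord upperWord   : Word
      .lowerWidth           : wordWidth lowerWord ≡ n
      .upperWidth           : wordWidth upperWord ≡ n
      .commonBreakpointFree : CommonBreakpointFree 0 lowerWord upperWord
      .weight               : k * #H lowerWord + k * #H upperWord ≡ h

  wordPair-≡ : ∀ {n h} {p q : WordPair n h} →
               .(WordPair.lowerWord p ≡ WordPair.lowerWord q) →
               .(WordPair.upperWord p ≡ WordPair.upperWord q) → p ≡ q
  wordPair-≡ {p = wordPair u w _ _ _ _} {wordPair u′ w′ _ _ _ _} u≡u′ w≡w′
    with recompute (List.≡-dec _≟ᴼ_ u u′) u≡u′ | recompute (List.≡-dec _≟ᴼ_ w w′) w≡w′
  ... | refl | refl = refl

  vfTiling-≡ : ∀ {n h} {t t′ : VFTiling k n h} → .(VFTiling.grid t ≡ VFTiling.grid t′) → t ≡ t′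
  vfTiling-≡ {t = mkVFT g _ _ _ _} {mkVFT g′ _ _ _ _} g≡g′
    with recompute (Vec.≡-dec (Vec.≡-dec (Maybe.≡-dec _≟ᴼ_)) g g′) g≡g′
  ... | refl = refl

  vfTilings↔wordPairs : ∀ {n h} → VFTiling k n h ↔ WordPair n h
  vfTilings↔wordPairs {n} {h} = mk↔ₛ′ toWords fromWords toWords∘fromWords fromWords∘toWords
    where
    toWords : VFTiling k n h → WordPair n h
    toWords (mkVFT g T hf free numH≡h) =
      wordPair (lowerWordOf g) (upperWordOf g) (lowerWordOf-width g T hf) (upperWordOf-width g T hf)
               (wordsOf-commonBreakpointFree g T hf free) (wordsOf-weight g T hf numH≡h)

    fromWords : WordPair n h → VFTiling k n h
    fromWords (wordPair u w u≡n w≡n free weight) =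
      mkVFT (stackedGrid n u w) (stackedGrid-isTiling u w u≡n w≡n) (stackedGrid-horizontalFault u w u≡n w≡n)
            (stackedGrid-faultFree u w u≡n w≡n free) (trans (numH-stack u w u≡n w≡n) weight)

    toWords∘fromWords : ∀ p → toWords (fromWords p) ≡ p
    toWords∘fromWords (wordPair u w u≡n w≡n _ _) =
      wordPair-≡ (proj₁ (readWord-stackedGrid u w u≡n w≡n)) (proj₂ (readWord-stackedGrid u w u≡n w≡n))

    fromWords∘toWords : ∀ t → fromWords (toWords t) ≡ t
    fromWords∘toWords (mkVFT g T hf _ _) = vfTiling-≡ (stackedGrid-wordsOf g T hf)

  -- Staggered word pairs and compositions

  wordWidth-++ : ∀ u v → wordWidth (u ++ v) ≡ wordWidth u + wordWidth v
  wordWidth-++ []      v = refl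
  wordWidth-++ (o ∷ u) v = trans (cong (width k o +_) (wordWidth-++ u v)) (sym (+-assoc (width k o) _ _))

  wordWidth-replicate-V : ∀ j → wordWidth (replicate j V) ≡ j
  wordWidth-replicate-V zero    = refl
  wordWidth-replicate-V (suc j) = cong suc (wordWidth-replicate-V j)

  wordWidth≡0⇒[] : ∀ {u} → wordWidth u ≡ 0 → u ≡ []
  wordWidth≡0⇒[] {[]}    _  = refl
  wordWidth≡0⇒[] {H ∷ _} ()
  wordWidth≡0⇒[] {V ∷ _} ()

  narrow⇒vertical : ∀ u → wordWidth u < k → u ≡ replicate (wordWidth u) V
  narrow⇒vertical []      _     = refl
  narrow⇒vertical (V ∷ u) u<k   = cong (V ∷_) (narrow⇒vertical u (<-trans (n<1+n _) u<k))
  narrow⇒vertical (H ∷ u) k+u<k = ⊥-elim (m+n≮m k _ k+u<k)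

  breakpoint-∷ : ∀ {o u c} → Breakpoint (o ∷ u) c → c ≡ 0 ⊎ Σ ℕ λ d → c ≡ width k o + d × Breakpoint u d
  breakpoint-∷ start      = inj₁ refl
  breakpoint-∷ (after bp) = inj₂ (_ , refl , bp)

  breakpoint-replicate-V-++ : ∀ j {u c} → Breakpoint (replicate j V ++ u) c →
                              c ≤ j ⊎ Σ ℕ λ d → c ≡ j + d × Breakpoint u d
  breakpoint-replicate-V-++ zero    bp         = inj₂ (_ , refl , bp)
  breakpoint-replicate-V-++ (suc j) start      = inj₁ z≤n
  breakpoint-replicate-V-++ (suc j) (after bp) with breakpoint-replicate-V-++ j bp
  ... | inj₁ c≤j           = inj₁ (s≤s c≤j)
  ... | inj₂ (d , refl , bp′) = inj₂ (d , refl , bp′)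

  -- H ∷ leaderTail β starts with an H-block at column 0, and follower e β is the other
  -- word from column e on.  The first part p of β is the column at which the follower's
  -- next H-block starts; that block then leads, and the rest of the old leader follows
  -- it from column k ∸ p.  TComp(m, k) corresponds to the pairs
  -- (H ∷ leaderTail β , V ∷ follower 1 β) of width k + m.
  mutual
    leaderTail : List ℕ → Word
    leaderTail []      = []
    leaderTail (p ∷ β) = follower (k ∸ p) β

    follower : ℕ → List ℕ → Word
    follower e []      = replicate (k ∸ e) V
    follower e (p ∷ β) = replicate (p ∸ e) V ++ H ∷ leaderTail β

  decode : ℕ → Word → Word → List ℕ
  decode e []          X       = []
  decode e Y@(_ ∷ _)   []      = []
  decode e Y@(_ ∷ _)   (V ∷ X) = decode (suc e) Y X
  decode e Y@(_ ∷ _)   (H ∷ X) = e ∷ decode (k ∸ e) X Y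

  data Admissible : ℕ → List ℕ → Set where
    []  : ∀ {e} → Admissible e []
    _∷_ : ∀ {e p β} → e ≤ p × p < k → Admissible (k ∸ p) β → Admissible e (p ∷ β)

  mutual
    leaderTail-width : ∀ {e β} → Admissible e β → wordWidth (leaderTail β) ≡ sum β
    leaderTail-width []                         = refl
    leaderTail-width {β = p ∷ β} ((_ , p<k) ∷ adm) = +-cancelʳ-≡ k _ _ (begin
      F + k               ≡⟨ cong (F +_) (m∸n+n≡m (<⇒≤ p<k)) ⟨
      F + ((k ∸ p) + p)   ≡⟨ +-assoc F (k ∸ p) p ⟨
      (F + (k ∸ p)) + p   ≡⟨ cong (_+ p) (follower-width adm (m∸n≤m k p)) ⟩
      (k + sum β) + p     ≡⟨ k+s+p≡p+s+k k (sum β) p ⟩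
      (p + sum β) + k     ∎)
      where
      open ≡-Reasoning
      F = wordWidth (follower (k ∸ p) β)
      k+s+p≡p+s+k : ∀ k s p → (k + s) + p ≡ (p + s) + k
      k+s+p≡p+s+k = solve-∀

    follower-width : ∀ {e β} → Admissible e β → e ≤ k → wordWidth (follower e β) + e ≡ k + sum β
    follower-width {e} {[]} [] e≤k = begin
      wordWidth (replicate (k ∸ e) V) + e ≡⟨ cong (_+ e) (wordWidth-replicate-V (k ∸ e)) ⟩
      (k ∸ e) + e                         ≡⟨ m∸n+n≡m e≤k ⟩
      k                                   ≡⟨ +-identityʳ k ⟨
      k + 0                               ∎
      where open ≡-Reasoning
    follower-width {e} {p ∷ β} ((e≤p , _) ∷ adm) _ = begin
      wordWidth (replicate (p ∸ e) V ++ H ∷ leaderTail β) + e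
        ≡⟨ cong (_+ e) (trans (wordWidth-++ (replicate (p ∸ e) V) _)
                              (cong₂ _+_ (wordWidth-replicate-V (p ∸ e)) (cong (k +_) (leaderTail-width adm)))) ⟩
      ((p ∸ e) + (k + sum β)) + e
        ≡⟨ q+[k+s]+e≡k+[q+e+s] (p ∸ e) k (sum β) e ⟩
      k + (((p ∸ e) + e) + sum β)
        ≡⟨ cong (λ q → k + (q + sum β)) (m∸n+n≡m e≤p) ⟩
      k + (p + sum β) ∎
      where
      open ≡-Reasoning
      q+[k+s]+e≡k+[q+e+s] : ∀ q k s e → (q + (k + s)) + e ≡ k + ((q + e) + s)
      q+[k+s]+e≡k+[q+e+s] = solve-∀

  leaderTail-follower-#H : ∀ e β → #H (leaderTail β) + #H (follower e β) ≡ length β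
  leaderTail-follower-#H e []      =
    trans (cong #H (sym (List.++-identityʳ (replicate (k ∸ e) V)))) (#H-replicate-V-++ (k ∸ e) [])
  leaderTail-follower-#H e (p ∷ β) = begin
    #H (follower (k ∸ p) β) + #H (replicate (p ∸ e) V ++ H ∷ leaderTail β)
      ≡⟨ cong (#H (follower (k ∸ p) β) +_) (#H-replicate-V-++ (p ∸ e) _) ⟩
    #H (follower (k ∸ p) β) + suc (#H (leaderTail β))
      ≡⟨ +-suc _ _ ⟩
    suc (#H (follower (k ∸ p) β) + #H (leaderTail β))
      ≡⟨ cong suc (trans (+-comm (#H (follower (k ∸ p) β)) _) (leaderTail-follower-#H (k ∸ p) β)) ⟩
    suc (length β) ∎
    where open ≡-Reasoning

  staggered-commonBreakpointFree : ∀ {e β} → Admissible e β →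
                                   CommonBreakpointFree e (H ∷ leaderTail β) (follower e β)
  staggered-commonBreakpointFree {e} {[]} [] c 0<e+c e+c<k+0 bpY _ with breakpoint-∷ bpY
  ... | inj₁ e+c≡0           = <-irrefl (sym e+c≡0) 0<e+c
  ... | inj₂ (d , e+c≡k+d , _) = <⇒≱ e+c<k+0 (subst (k + 0 ≤_) (sym e+c≡k+d) (+-monoʳ-≤ k z≤n))
  staggered-commonBreakpointFree {e} {p ∷ β} ((e≤p , p<k) ∷ adm) c 0<e+c e+c<k+F bpY bpX
    with breakpoint-∷ bpY | breakpoint-replicate-V-++ (p ∸ e) bpX
  ... | inj₁ e+c≡0 | _ = <-irrefl (sym e+c≡0) 0<e+c
  ... | inj₂ (d , e+c≡k+d , _) | inj₁ c≤p∸e =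
    <⇒≱ p<k (begin
      k           ≤⟨ m≤m+n k d ⟩
      k + d       ≡⟨ e+c≡k+d ⟨
      e + c       ≤⟨ +-monoʳ-≤ e c≤p∸e ⟩
      e + (p ∸ e) ≡⟨ m+[n∸m]≡n e≤p ⟩
      p           ∎)
    where open ≤-Reasoning
  ... | inj₂ (d , e+c≡k+d , bpF) | inj₂ (c′ , refl , bpL) =
    staggered-commonBreakpointFree adm d (≤-trans (m<n⇒0<n∸m p<k) (m≤m+n (k ∸ p) d)) bound
      (subst (Breakpoint (H ∷ leaderTail β)) c′≡k∸p+d bpL) bpF
    where
    open ≡-Reasoning
    F = wordWidth (follower (k ∸ p) β)
    k∸p+p≡k : (k ∸ p) + p ≡ k
    k∸p+p≡k = m∸n+n≡m (<⇒≤ p<k)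
    c′≡k∸p+d : c′ ≡ (k ∸ p) + d
    c′≡k∸p+d = +-cancelˡ-≡ p _ _ (begin
      p + c′                  ≡⟨ cong (_+ c′) (m+[n∸m]≡n e≤p) ⟨
      (e + (p ∸ e)) + c′      ≡⟨ +-assoc e (p ∸ e) c′ ⟩
      e + ((p ∸ e) + c′)      ≡⟨ e+c≡k+d ⟩
      k + d                   ≡⟨ cong (_+ d) (trans (sym k∸p+p≡k) (+-comm (k ∸ p) p)) ⟩
      (p + (k ∸ p)) + d       ≡⟨ +-assoc p (k ∸ p) d ⟩
      p + ((k ∸ p) + d)       ∎)
    bound : (k ∸ p) + d < k + wordWidth (leaderTail β)
    bound = subst ((k ∸ p) + d <_)
              (trans (+-comm (k ∸ p) F)
                     (trans (follower-width adm (m∸n≤m k p)) (cong (k +_) (sym (leaderTail-width adm)))))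
              (+-monoʳ-< (k ∸ p) (+-cancelˡ-< k _ _ (subst (_< k + F) e+c≡k+d e+c<k+F)))

  follower-nonempty : ∀ {e} β → e < k → follower e β ≢ []
  follower-nonempty {e} []      e<k eq =
    m>n⇒m∸n≢0 e<k (trans (sym (List.length-replicate (k ∸ e))) (cong length eq))
  follower-nonempty {e} (p ∷ β) _   eq with () ← List.++-conicalʳ (replicate (p ∸ e) V) _ eq

  decode-replicate-V : ∀ j {e} Y X → Y ≢ [] → decode e Y (replicate j V ++ X) ≡ decode (j + e) Y X
  decode-replicate-V j       []      X Y≢[] = ⊥-elim (Y≢[] refl)
  decode-replicate-V zero    (o ∷ Y) X _    = refl
  decode-replicate-V (suc j) {e} (o ∷ Y) X Y≢[] =
    trans (decode-replicate-V j (o ∷ Y) X Y≢[]) (cong (λ e → decode e (o ∷ Y) X) (+-suc j e))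

  decode-H : ∀ {e} Y X → Y ≢ [] → decode e Y (H ∷ X) ≡ e ∷ decode (k ∸ e) X Y
  decode-H []      X Y≢[] = ⊥-elim (Y≢[] refl)
  decode-H (o ∷ Y) X _    = refl

  decode-staggered : ∀ {e β} → 1 ≤ e → Admissible e β → decode e (leaderTail β) (follower e β) ≡ β
  decode-staggered             _   []                 = refl
  decode-staggered {e} {p ∷ β} 1≤e ((e≤p , p<k) ∷ adm) = begin
    decode e F (replicate (p ∸ e) V ++ H ∷ leaderTail β)
      ≡⟨ decode-replicate-V (p ∸ e) F _ F≢[] ⟩
    decode ((p ∸ e) + e) F (H ∷ leaderTail β)
      ≡⟨ cong (λ q → decode q F (H ∷ leaderTail β)) (m∸n+n≡m e≤p) ⟩
    decode p F (H ∷ leaderTail β)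
      ≡⟨ decode-H F (leaderTail β) F≢[] ⟩
    p ∷ decode (k ∸ p) (leaderTail β) F
      ≡⟨ cong (p ∷_) (decode-staggered (m<n⇒0<n∸m p<k) adm) ⟩
    p ∷ β
      ∎
    where
    open ≡-Reasoning
    F = follower (k ∸ p) β
    F≢[] : F ≢ []
    F≢[] = follower-nonempty β (∸-monoʳ-< (≤-trans 1≤e e≤p) (<⇒≤ p<k))

  admissible-pred : ∀ {e β} → Admissible (suc e) β → Admissible e β
  admissible-pred []                   = []
  admissible-pred ((e<p , p<k) ∷ adm) = (<⇒≤ e<p , p<k) ∷ adm

  follower-pred : ∀ {e β} → e < k → Admissible (suc e) β → follower e β ≡ V ∷ follower (suc e) β
  follower-pred e<k []                   = cong (λ j → replicate j V) (+-∸-assoc 1 e<k)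
  follower-pred {β = p ∷ β} _ ((e<p , _) ∷ _) = cong (λ j → replicate j V ++ H ∷ leaderTail β) (+-∸-assoc 1 e<p)

  starts-before-k : ∀ {e o Y X} → 1 ≤ e → e ≤ k → CommonBreakpointFree e (H ∷ o ∷ Y) X → e < k
  starts-before-k {e} {o} {Y} 1≤e e≤k free with e <? k
  ... | yes e<k = e<k
  ... | no  e≮k with ≤∧≮⇒≡ e≤k e≮k
  ...   | refl = ⊥-elim (free 0 (subst (0 <_) (sym (+-identityʳ k)) 1≤e)
                              (+-monoʳ-< k (<-≤-trans (0<width o) (m≤m+n _ (wordWidth Y)))) (after start) start)

  commonBreakpointFree-drop-V : ∀ {e Y X} → CommonBreakpointFree e Y (V ∷ X) → CommonBreakpointFree (suc e) Y X
  commonBreakpointFree-drop-V {e} free c rewrite sym (+-suc e c) =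
    λ 0<e+c e+c<w bpY bpX → free (suc c) 0<e+c e+c<w bpY (after bpX)

  swap-width : ∀ {e a b} → e ≤ k → k + a ≡ e + (k + b) → k + b ≡ (k ∸ e) + a
  swap-width {e} {a} {b} e≤k width = +-cancelˡ-≡ e _ _ (begin
    e + (k + b)       ≡⟨ width ⟨
    k + a             ≡⟨ cong (_+ a) (m+[n∸m]≡n e≤k) ⟨
    (e + (k ∸ e)) + a ≡⟨ +-assoc e (k ∸ e) a ⟩
    e + ((k ∸ e) + a) ∎)
    where open ≡-Reasoning

  -- The H-block of X at column e of Y takes the lead, and Y resumes at column k,
  -- which is column k ∸ e of that block.
  commonBreakpointFree-swap : ∀ {e Y X} → e ≤ k → k + wordWidth Y ≡ e + (k + wordWidth X) →
                              CommonBreakpointFree e (H ∷ Y) (H ∷ X) → CommonBreakpointFree (k ∸ e) (H ∷ X) Y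
  commonBreakpointFree-swap {e} {Y} {X} e≤k width free c _ k∸e+c<w bpX bpY =
    free ((k ∸ e) + c)
         (subst (0 <_) (sym e+[k∸e+c]≡k+c) (<-≤-trans (0<width H) (m≤m+n k c)))
         (subst (_< k + wordWidth Y) (sym e+[k∸e+c]≡k+c)
                (+-monoʳ-< k (+-cancelˡ-< (k ∸ e) _ _ (subst ((k ∸ e) + c <_) (swap-width e≤k width) k∸e+c<w))))
         (subst (Breakpoint (H ∷ Y)) (sym e+[k∸e+c]≡k+c) (after bpY))
         bpX
    where
    e+[k∸e+c]≡k+c : e + ((k ∸ e) + c) ≡ k + c
    e+[k∸e+c]≡k+c = trans (sym (+-assoc e (k ∸ e) c)) (cong (_+ c) (m+[n∸m]≡n e≤k))

  staggered-decode : ∀ e Y X → 1 ≤ e → e ≤ k → k + wordWidth Y ≡ e + wordWidth X →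
                     CommonBreakpointFree e (H ∷ Y) X →
                     let β = decode e Y X in Admissible e β × leaderTail β ≡ Y × follower e β ≡ X
  staggered-decode e [] X 1≤e e≤k width _ =
    [] , refl , sym (trans (narrow⇒vertical X (subst (_< k) (sym X≡k∸e) (∸-monoʳ-< 1≤e e≤k)))
                           (cong (λ j → replicate j V) X≡k∸e))
    where
    X≡k∸e : wordWidth X ≡ k ∸ e
    X≡k∸e = sym (trans (cong (_∸ e) (trans (sym (+-identityʳ k)) width)) (m+n∸m≡n e (wordWidth X)))
  staggered-decode e (o ∷ Y) [] 1≤e e≤k width _ =
    ⊥-elim (<⇒≱ (m<m+n k (<-≤-trans (0<width o) (m≤m+n _ (wordWidth Y))))
                (subst (_≤ k) (sym (trans width (+-identityʳ e))) e≤k))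
  staggered-decode e (o ∷ Y) (V ∷ X) 1≤e e≤k width free =
    let e<k = starts-before-k 1≤e e≤k free
        adm , leader≡ , follower≡ =
          staggered-decode (suc e) (o ∷ Y) X (s≤s z≤n) e<k (trans width (+-suc e _))
                           (commonBreakpointFree-drop-V free)
    in admissible-pred adm , leader≡ , trans (follower-pred e<k adm) (cong (V ∷_) follower≡)
  staggered-decode e (o ∷ Y) (H ∷ X) 1≤e e≤k width free =
    let e<k = starts-before-k 1≤e e≤k free
        adm , leader≡ , follower≡ =
          staggered-decode (k ∸ e) X (o ∷ Y) (m<n⇒0<n∸m e<k) (m∸n≤m k e)
                           (swap-width e≤k width) (commonBreakpointFree-swap e≤k width free)
    in (≤-refl , e<k) ∷ adm , follower≡ ,
       trans (cong (λ j → replicate j V ++ H ∷ leaderTail (decode (k ∸ e) X (o ∷ Y))) (n∸n≡0 e))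
             (cong (H ∷_) leader≡)

  admissible⇒positive : ∀ {e β} → 1 ≤ e → Admissible e β → All (1 ≤_) β
  admissible⇒positive _   []                   = []
  admissible⇒positive 1≤e ((e≤p , p<k) ∷ adm) = ≤-trans 1≤e e≤p ∷ admissible⇒positive (m<n⇒0<n∸m p<k) adm

  admissible⇒small : ∀ {e β} → Admissible e β → All (_< k) β
  admissible⇒small []                 = []
  admissible⇒small ((_ , p<k) ∷ adm) = p<k ∷ admissible⇒small adm

  admissible⇒linked : ∀ {e β} → Admissible e β → Linked (λ a b → k ≤ a + b) β
  admissible⇒linked []                     = []
  admissible⇒linked (_ ∷ [])               = [-]
  admissible⇒linked {β = p ∷ q ∷ _} ((_ , p<k) ∷ adm@((k∸p≤q , _) ∷ _)) =
    subst (_≤ p + q) (m+[n∸m]≡n (<⇒≤ p<k)) (+-monoʳ-≤ p k∸p≤q) ∷ admissible⇒linked adm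

  linked⇒admissible : ∀ {e p β} → e ≤ p → All (_< k) (p ∷ β) → Linked (λ a b → k ≤ a + b) (p ∷ β) →
                      Admissible e (p ∷ β)
  linked⇒admissible e≤p (p<k ∷ [])    [-]               = (e≤p , p<k) ∷ []
  linked⇒admissible {p = p} e≤p (p<k ∷ small) (k≤p+q ∷ linked) =
    (e≤p , p<k) ∷ linked⇒admissible (m≤n+o⇒m∸n≤o k p k≤p+q) small linked

  tcomp⇒admissible : ∀ {β} → All (1 ≤_) β → All (_< k) β → Linked (λ a b → k ≤ a + b) β → Admissible 1 β
  tcomp⇒admissible []          _     _      = []
  tcomp⇒admissible (1≤p ∷ _) small linked = linked⇒admissible 1≤p small linked

  -- Word pairs and the right-hand side

  singleton-commonBreakpointFree : ∀ o → CommonBreakpointFree 0 (o ∷ []) (o ∷ [])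
  singleton-commonBreakpointFree o c 0<c c<w bp _ with breakpoint-∷ bp
  ... | inj₁ refl           = <-irrefl refl 0<c
  ... | inj₂ (d , refl , _) = <⇒≱ c<w (+-monoʳ-≤ (width k o) z≤n)

  commonBreakpointFree-sym : ∀ {u w} → wordWidth u ≡ wordWidth w →
                             CommonBreakpointFree 0 u w → CommonBreakpointFree 0 w u
  commonBreakpointFree-sym u≡w free c 0<c c<w bpw bpu = free c 0<c (subst (c <_) (sym u≡w) c<w) bpu bpw

  sameStart⇒singletons : ∀ o {u w} → wordWidth u ≡ wordWidth w → CommonBreakpointFree 0 (o ∷ u) (o ∷ w) →
                         u ≡ [] × w ≡ []
  sameStart⇒singletons o {[]}     u≡w _    = refl , wordWidth≡0⇒[] (sym u≡w)
  sameStart⇒singletons o {o′ ∷ u} _   free = ⊥-elim (free (width k o + 0)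
    (<-≤-trans (0<width o) (m≤m+n _ 0))
    (+-monoʳ-< (width k o) (<-≤-trans (0<width o′) (m≤m+n _ (wordWidth u))))
    (after start) (after start))

  swapWordPair : ∀ {n h} → WordPair n h → WordPair n h
  swapWordPair (wordPair u w u≡n w≡n free weight) =
    wordPair w u w≡n u≡n (commonBreakpointFree-sym (trans u≡n (sym w≡n)) free)
             (trans (+-comm (k * #H w) _) weight)

  staggered-weight : ∀ β → k * #H (H ∷ leaderTail β) + k * #H (V ∷ follower 1 β) ≡ k + k * length β
  staggered-weight β = begin
    k * suc (#H (leaderTail β)) + k * #H (follower 1 β) ≡⟨ *-distribˡ-+ k (suc (#H (leaderTail β))) _ ⟨
    k * suc (#H (leaderTail β) + #H (follower 1 β))     ≡⟨ cong (λ l → k * suc l) (leaderTail-follower-#H 1 β) ⟩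
    k * suc (length β)                                   ≡⟨ *-suc k (length β) ⟩
    k + k * length β                                     ∎
    where open ≡-Reasoning

  staggered-commonBreakpointFree₀ : ∀ {β} → Admissible 1 β →
                                    CommonBreakpointFree 0 (H ∷ leaderTail β) (V ∷ follower 1 β)
  staggered-commonBreakpointFree₀ adm c 0<c c<w bpY bpX with breakpoint-∷ bpX
  ... | inj₁ refl            = <-irrefl refl 0<c
  ... | inj₂ (d , refl , bp) = staggered-commonBreakpointFree adm d (s≤s z≤n) c<w bpY bp

  staggeredWordPair : ∀ {n h} β → .(Admissible 1 β) → .(n ≡ k + sum β) → .(h ≡ k + k * length β) → WordPair n h
  staggeredWordPair β adm n≡ h≡ =
    wordPair (H ∷ leaderTail β) (V ∷ follower 1 β)
      (trans (cong (k +_) (leaderTail-width adm)) (sym n≡))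
      (trans (+-comm 1 _) (trans (follower-width adm (s≤s z≤n)) (sym n≡)))
      (staggered-commonBreakpointFree₀ adm)
      (trans (staggered-weight β) (sym h≡))

  staggered-decode-wordPair : ∀ {n h} Y X → wordWidth (H ∷ Y) ≡ n → wordWidth (V ∷ X) ≡ n →
    CommonBreakpointFree 0 (H ∷ Y) (V ∷ X) → k * #H (H ∷ Y) + k * #H (V ∷ X) ≡ h →
    let β = decode 1 Y X in
    (Admissible 1 β × n ≡ k + sum β × h ≡ k + k * length β) × leaderTail β ≡ Y × follower 1 β ≡ X
  staggered-decode-wordPair {n} {h} Y X Y≡n X≡n free weight =
    (adm , n≡ , h≡) , leader≡ , follower≡
    where
    decoded = staggered-decode 1 Y X ≤-refl (s≤s z≤n) (trans Y≡n (sym X≡n))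
                (commonBreakpointFree-drop-V free)
    β = decode 1 Y X
    adm = proj₁ decoded
    leader≡ = proj₁ (proj₂ decoded)
    follower≡ = proj₂ (proj₂ decoded)
    n≡ : n ≡ k + sum β
    n≡ = trans (sym Y≡n) (cong (k +_) (trans (cong wordWidth (sym leader≡)) (leaderTail-width adm)))
    h≡ : h ≡ k + k * length β
    h≡ = trans (sym weight)
           (trans (cong₂ (λ Y′ X′ → k * #H (H ∷ Y′) + k * #H (V ∷ X′)) (sym leader≡) (sym follower≡))
                  (staggered-weight β))

  staggered-decode-swappedPair : ∀ {n h} Y X → wordWidth (V ∷ X) ≡ n → wordWidth (H ∷ Y) ≡ n →
    CommonBreakpointFree 0 (V ∷ X) (H ∷ Y) → k * #H (V ∷ X) + k * #H (H ∷ Y) ≡ h →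
    let β = decode 1 Y X in
    (Admissible 1 β × n ≡ k + sum β × h ≡ k + k * length β) × leaderTail β ≡ Y × follower 1 β ≡ X
  staggered-decode-swappedPair Y X X≡n Y≡n free weight =
    staggered-decode-wordPair Y X Y≡n X≡n (commonBreakpointFree-sym (trans X≡n (sym Y≡n)) free)
                              (trans (+-comm (k * #H (H ∷ Y)) _) weight)

  staggeredTerm : ∀ {n h} → Fin 2 → ∀ β → .(Admissible 1 β × n ≡ k + sum β × h ≡ k + k * length β) →
                  RHSTerm k n h
  staggeredTerm {n} {h} i β facts =
    inj₂ (inj₂ (i , sum β ,
      mkTComp β (admissible⇒positive ≤-refl (proj₁ facts)) refl
                (admissible⇒small (proj₁ facts)) (admissible⇒linked (proj₁ facts)) ,
      recompute (n ≟ k + sum β) (proj₁ (proj₂ facts)) ,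
      recompute (h ≟ k + k * length β) (proj₂ (proj₂ facts))))

  staggeredTerm-≡ : ∀ {n h} i {m m′} (t : TComp m k) (t′ : TComp m′ k) {e₁ e₂ e₁′ e₂′} →
                    .(TComp.parts t ≡ TComp.parts t′) →
                    (RHSTerm k n h ∋ inj₂ (inj₂ (i , m , t , e₁ , e₂))) ≡ inj₂ (inj₂ (i , m′ , t′ , e₁′ , e₂′))
  staggeredTerm-≡ i {m} {m′} (mkTComp ps pos sums small linked) (mkTComp ps′ _ sums′ _ _) ps≡ps′
    with recompute (List.≡-dec _≟_ ps ps′) ps≡ps′
  ... | refl with recompute (m ≟ m′) (trans (sym sums) sums′)
  ... | refl = cong₂ (λ e₁ e₂ → inj₂ (inj₂ (i , m , mkTComp ps pos sums small linked , e₁ , e₂)))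
                     (≡-irrelevant _ _) (≡-irrelevant _ _)

  k*1+k*1≡2*k : k * 1 + k * 1 ≡ 2 * k
  k*1+k*1≡2*k = trans (cong₂ _+_ (*-identityʳ k) (*-identityʳ k)) (cong (k +_) (sym (+-identityʳ k)))

  verticalPair : ∀ {n h u w} → wordWidth (V ∷ u) ≡ n → wordWidth (V ∷ w) ≡ n →
                 CommonBreakpointFree 0 (V ∷ u) (V ∷ w) → k * #H (V ∷ u) + k * #H (V ∷ w) ≡ h →
                 (n ≡ 1 × h ≡ 0) × u ≡ [] × w ≡ []
  verticalPair u≡n w≡n free weight with sameStart⇒singletons V (+-cancelˡ-≡ 1 _ _ (trans u≡n (sym w≡n))) free
  ... | refl , refl = (sym u≡n , trans (sym weight) (cong₂ _+_ (*-zeroʳ k) (*-zeroʳ k))) , refl , refl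

  horizontalPair : ∀ {n h u w} → wordWidth (H ∷ u) ≡ n → wordWidth (H ∷ w) ≡ n →
                   CommonBreakpointFree 0 (H ∷ u) (H ∷ w) → k * #H (H ∷ u) + k * #H (H ∷ w) ≡ h →
                   (n ≡ k × h ≡ 2 * k) × u ≡ [] × w ≡ []
  horizontalPair u≡n w≡n free weight with sameStart⇒singletons H (+-cancelˡ-≡ k _ _ (trans u≡n (sym w≡n))) free
  ... | refl , refl = (trans (sym u≡n) (+-identityʳ k) , trans (sym weight) k*1+k*1≡2*k) , refl , refl

  recompute-≡×≡ : ∀ {a b c d : ℕ} → .(a ≡ b × c ≡ d) → a ≡ b × c ≡ d
  recompute-≡×≡ p = recompute (_ ≟ _) (proj₁ p) , recompute (_ ≟ _) (proj₂ p)

  fromRHS : ∀ {n h} → RHSTerm k n h → WordPair n h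
  fromRHS (inj₁ (n≡1 , h≡0)) =
    wordPair (V ∷ []) (V ∷ []) (sym n≡1) (sym n≡1) (singleton-commonBreakpointFree V)
             (trans (cong₂ _+_ (*-zeroʳ k) (*-zeroʳ k)) (sym h≡0))
  fromRHS (inj₂ (inj₁ (n≡k , h≡2k))) =
    wordPair (H ∷ []) (H ∷ []) (trans (+-identityʳ k) (sym n≡k)) (trans (+-identityʳ k) (sym n≡k))
             (singleton-commonBreakpointFree H) (trans k*1+k*1≡2*k (sym h≡2k))
  fromRHS (inj₂ (inj₂ (zero , m , mkTComp β pos sums small linked , n≡ , h≡))) =
    staggeredWordPair β (tcomp⇒admissible pos small linked) (trans n≡ (cong (k +_) (sym sums))) h≡
  fromRHS (inj₂ (inj₂ (suc zero , m , mkTComp β pos sums small linked , n≡ , h≡))) =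
    swapWordPair (staggeredWordPair β (tcomp⇒admissible pos small linked) (trans n≡ (cong (k +_) (sym sums))) h≡)

  toRHS : ∀ {n h} → 1 ≤ n → WordPair n h → RHSTerm k n h
  toRHS 1≤n (wordPair []      _  u≡n _   _ _) = ⊥-elim-irr (<⇒≱ 1≤n (≤-reflexive (sym u≡n)))
  toRHS 1≤n (wordPair (_ ∷ _) [] _   w≡n _ _) = ⊥-elim-irr (<⇒≱ 1≤n (≤-reflexive (sym w≡n)))
  toRHS _ (wordPair (V ∷ u) (V ∷ w) u≡n w≡n free weight) =
    inj₁ (recompute-≡×≡ (proj₁ (verticalPair u≡n w≡n free weight)))
  toRHS _ (wordPair (H ∷ u) (H ∷ w) u≡n w≡n free weight) =
    inj₂ (inj₁ (recompute-≡×≡ (proj₁ (horizontalPair u≡n w≡n free weight))))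
  toRHS _ (wordPair (H ∷ Y) (V ∷ X) Y≡n X≡n free weight) =
    staggeredTerm zero (decode 1 Y X) (proj₁ (staggered-decode-wordPair Y X Y≡n X≡n free weight))
  toRHS _ (wordPair (V ∷ X) (H ∷ Y) X≡n Y≡n free weight) =
    staggeredTerm (suc zero) (decode 1 Y X) (proj₁ (staggered-decode-swappedPair Y X X≡n Y≡n free weight))

  wordPairs↔rhsTerms : ∀ {n h} → 1 ≤ n → WordPair n h ↔ RHSTerm k n h
  wordPairs↔rhsTerms 1≤n = mk↔ₛ′ (toRHS 1≤n) fromRHS toRHS∘fromRHS fromRHS∘toRHS
    where
    toRHS∘fromRHS : ∀ r → toRHS 1≤n (fromRHS r) ≡ r
    toRHS∘fromRHS (inj₁ _) = cong inj₁ (cong₂ _,_ (≡-irrelevant _ _) (≡-irrelevant _ _))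
    toRHS∘fromRHS (inj₂ (inj₁ _)) = cong (inj₂ ∘ inj₁) (cong₂ _,_ (≡-irrelevant _ _) (≡-irrelevant _ _))
    toRHS∘fromRHS (inj₂ (inj₂ (zero , m , t@(mkTComp β pos _ small linked) , _))) =
      staggeredTerm-≡ zero _ t (decode-staggered ≤-refl (tcomp⇒admissible pos small linked))
    toRHS∘fromRHS (inj₂ (inj₂ (suc zero , m , t@(mkTComp β pos _ small linked) , _))) =
      staggeredTerm-≡ (suc zero) _ t (decode-staggered ≤-refl (tcomp⇒admissible pos small linked))

    fromRHS∘toRHS : ∀ p → fromRHS (toRHS 1≤n p) ≡ p
    fromRHS∘toRHS (wordPair [] _ u≡n _ _ _) =
      wordPair-≡ (⊥-elim (<⇒≱ 1≤n (≤-reflexive (sym u≡n)))) (⊥-elim (<⇒≱ 1≤n (≤-reflexive (sym u≡n))))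
    fromRHS∘toRHS (wordPair (_ ∷ _) [] _ w≡n _ _) =
      wordPair-≡ (⊥-elim (<⇒≱ 1≤n (≤-reflexive (sym w≡n)))) (⊥-elim (<⇒≱ 1≤n (≤-reflexive (sym w≡n))))
    fromRHS∘toRHS (wordPair (V ∷ u) (V ∷ w) u≡n w≡n free weight) =
      wordPair-≡ (cong (V ∷_) (sym (proj₁ (proj₂ (verticalPair u≡n w≡n free weight)))))
                 (cong (V ∷_) (sym (proj₂ (proj₂ (verticalPair u≡n w≡n free weight)))))
    fromRHS∘toRHS (wordPair (H ∷ u) (H ∷ w) u≡n w≡n free weight) =
      wordPair-≡ (cong (H ∷_) (sym (proj₁ (proj₂ (horizontalPair u≡n w≡n free weight)))))
                 (cong (H ∷_) (sym (proj₂ (proj₂ (horizontalPair u≡n w≡n free weight)))))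
    fromRHS∘toRHS (wordPair (H ∷ Y) (V ∷ X) Y≡n X≡n free weight) =
      wordPair-≡ (cong (H ∷_) (proj₁ (proj₂ (staggered-decode-wordPair Y X Y≡n X≡n free weight))))
                 (cong (V ∷_) (proj₂ (proj₂ (staggered-decode-wordPair Y X Y≡n X≡n free weight))))
    fromRHS∘toRHS (wordPair (V ∷ X) (H ∷ Y) X≡n Y≡n free weight) =
      wordPair-≡ (cong (V ∷_) (proj₂ (proj₂ (staggered-decode-swappedPair Y X X≡n Y≡n free weight))))
                 (cong (H ∷_) (proj₁ (proj₂ (staggered-decode-swappedPair Y X X≡n Y≡n free weight))))

-- The hypothesis 2 ≤ k only excludes k = 0: the argument works for every k ≥ 1.
proposition2p7 : (k : ℕ) → 2 ≤ k → (n : ℕ) → 1 ≤ n → (h : ℕ) →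
                 VFTiling k n h ↔ RHSTerm k n h
proposition2p7 (suc k-1) _ n 1≤n h = ↔-trans vfTilings↔wordPairs (wordPairs↔rhsTerms 1≤n)
  where open Tilings k-1
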